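{- Let $\mathcal T$ be a tower diagram, $\omega=\omega_{\mathcal T}$, $k$ a positive integer, and $i<j$ positive integers with $\ell(\omega t_{i,j})=\ell(\omega)+1$. Let $s$ be the tower of $\mathcal T$ with index $i$, let $r\ge0$ be such that the $s$-th tower of $\mathcal T_{\omega t_{i,j}}$ has height $\mathcal T_s+r+1$, and let $e_q=(s,\mathcal T_s+q)$, $0\le q\le r$, be the new cells added to that tower. Then the following are equivalent: (1) $i\le k<j$; (2) one of the cells $e_0,\ldots,e_r$ lies in the Schubert path of $k$ in $\mathcal T$. Moreover, in this case, the cell among $e_0,\ldots,e_r$ lying in the Schubert path is critical.
   Context: Permutations compose as functions; $t_{a,b}$ transposes $a,b$; $s_p=t_{p,p+1}$; $\ell$ is length. A tower diagram is a sequence $\mathcal T=(\mathcal T_1,\mathcal T_2,\ldots)$ of nonnegative integers, almost all zero. A cell is the south-east corner $(a,b)$ of $[a-1,a]\times[b,b+1]$; $(a,b)\in\mathcal T$ iff $0\le b<\mathcal T_a$. Sliding $i$ into $\mathcal T$: set $s:=i$, examine towers $p=1,2,\ldots$ with $h=\mathcal T_p$: if $s>p+h$ go on; if $s=p+h$ increase $\mathcal T_p$ by one and stop; if $h\ge1$ and $s=p+h-1$ decrease $\mathcal T_p$ by one and stop; if $s<p+h-1$ set $s:=s+1$ and go on. $\mathcal T_\omega$ is obtained by sliding a reduced word of $\omega$ letter by letter into the empty diagram; $\omega\mapsto\mathcal T_\omega$ is a bijection with inverse $\mathcal T\mapsto\omega_{\mathcal T}$. It is known that when $\ell(\omega t_{i,j})=\ell(\omega)+1$,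 the diagram $\mathcal T_{\omega t_{i,j}}$ differs from $\mathcal T$ by raising tower $s$ by some $r+1\ge1$ cells and lowering one other tower by $r$ cells. Flight path: for $c=(a,b)$, $\mathrm{fp}(\mathcal T,c)=\{c\}$ if $a=1$; otherwise with $d=(a-1,b)$, $e=(a-1,b+1)$, $\mathrm{fp}(\mathcal T,c)=\mathrm{fp}(\mathcal T,d)\cup\{c\}$ if $d\in\mathcal T$, else $\mathrm{fp}(\mathcal T,e)\cup\{c\}$; if $(1,y)\in\mathrm{fp}(\mathcal T,c)$ then $\mathrm{fn}(\mathcal T,c)=1+y$. The index of the $p$-th tower is $\mathrm{fn}(\mathcal T,(p,\mathcal T_p))$. Schubert path of $k$ in $\mathcal T$: the sequence of cells $\mathcal P$ starting at $(1,k-1)$ and continuing as follows: if the current cell $(a,b)$ lies in $\mathcal T$, the next cell is $(a+1,b)$; otherwise the next cell is $(a+1,b-1)$; the path stops at the first cell with second coordinate $-1$ (below the $x$-axis). Equivalently, the cell of $\mathcal P$ in column $a$ is the highest cell $(a,b)$ with $\mathrm{fn}(\mathcal T,(a,b))\le k$. Critical cells: let $c=(a,b)\in\mathcal P$ with $b\ge0$ and $c\notin\mathcal T$, and let $t=b-\mathcal T_a$ be the number of empty cells below $c$ in its column. Then $c$ is critical if $t=0$, or if $t>0$ and the first cell $d=(a',b')$ of $\mathcal P$ to the right of $c$ that lies in $\mathcal T$ exists and satisfies $b'+1\ge t$ (the number of cells of $\mathcal T$ on and below $d$ is at least $t$). -}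

module Defs where

open import Data.Nat using (ℕ; zero; suc; _+_; _∸_; _⊔_; _≤_; _<_; _<ᵇ_; _≡ᵇ_)
open import Data.Nat.Properties using (<-cmp)
open import Data.Bool using (Bool; true; false; if_then_else_)
open import Data.List using (List; []; _∷_; _++_; [_]; replicate; foldl; foldr; length)
open import Data.List.Relation.Unary.All using (All)
open import Data.Product using (_×_; Σ; ∃; ∃-syntax)
open import Data.Sum using (_⊎_)
open import Relation.Binary using (tri<; tri≈; tri>)
open import Relation.Binary.PropositionalEquality using (_≡_)
open import Relation.Nullary using (¬_)

-- Permutations of the positive integers, given by words / functions ℕ → ℕ
-- (0 is fixed by everything and plays no role).

transp : ℕ → ℕ → ℕ → ℕ
transp a b x = if x ≡ᵇ a then b else (if x ≡ᵇ b then a else x)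

sgen : ℕ → ℕ → ℕ
sgen p = transp p (suc p)

evalWord : List ℕ → ℕ → ℕ
evalWord []      x = x
evalWord (a ∷ w) x = sgen a (evalWord w x)

countAbove : (ℕ → ℕ) → ℕ → ℕ → ℕ
countAbove f y zero    = 0
countAbove f y (suc x) = (if f y <ᵇ f (suc x) then 1 else 0) + countAbove f y x

-- number of inversions of f inside {1,…,N}: pairs 1 ≤ x < y ≤ N, f x > f y.
-- For N beyond the support of f this is the Coxeter length ℓ(f).
inv : (ℕ → ℕ) → ℕ → ℕ
inv f zero    = 0
inv f (suc y) = countAbove f (suc y) y + inv f y

maxL : List ℕ → ℕ
maxL = foldr _⊔_ 0

-- support bound of the permutation of a word: letters ≤ maxL w, so
-- evalWord w moves only points in {1,…,maxL w + 1}
-- w is a reduced word (of positive letters) of the permutation it denotes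
Reduced : List ℕ → Set
Reduced w = All (1 ≤_) w × length w ≡ inv (evalWord w) (suc (maxL w))

-- Tower diagrams: list of heights T₁,T₂,…; towers beyond the list are 0.

height : List ℕ → ℕ → ℕ
height []      _             = 0
height (h ∷ T) zero          = 0   -- tower 0 does not exist
height (h ∷ T) (suc zero)    = h
height (h ∷ T) (suc (suc p)) = height T (suc p)

InT : List ℕ → ℕ → ℕ → Set
InT T a b = b < height T a

-- sliding s into the towers p, p+1, … (given as a list starting at tower p)
slideAt : ℕ → ℕ → List ℕ → List ℕ
-- all remaining towers have height 0; by the invariant s ≥ p the rules
-- pass over towers p, …, s-1 and raise tower s to height 1
slideAt p s []      = replicate (s ∸ p) 0 ++ [ 1 ]
slideAt p s (h ∷ T) with <-cmp s (p + h)
... | tri> _ _ _ = h ∷ slideAt (suc p) s T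
... | tri≈ _ _ _ = suc h ∷ T
slideAt p s (zero ∷ T)  | tri< _ _ _ = zero ∷ slideAt (suc p) (suc s) T  -- (excluded by s ≥ p)
slideAt p s (suc h ∷ T) | tri< _ _ _ =
  if suc s ≡ᵇ p + suc h
  then h ∷ T                                        -- s = p+h-1 : lower
  else suc h ∷ slideAt (suc p) (suc s) T

slide : ℕ → List ℕ → List ℕ
slide i T = slideAt 1 i T

-- T_ω for ω = evalWord w, w reduced: slide the letters a₁, a₂, … in order
towerOf : List ℕ → List ℕ
towerOf w = foldl (λ T a → slide a T) [] w

fn : List ℕ → ℕ → ℕ → ℕ
fn T zero          b = suc b   -- column 0 does not occur
fn T (suc zero)    b = suc b
fn T (suc (suc a)) b =
  if b <ᵇ height T (suc a) then fn T (suc a) b else fn T (suc a) (suc b)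

index : List ℕ → ℕ → ℕ
index T p = fn T p (height T p)

data InPath (T : List ℕ) (k : ℕ) : ℕ → ℕ → Set where
  start   : InPath T k 1 (k ∸ 1)
  stepIn  : ∀ {a b} → InPath T k a b → InT T a b → InPath T k (suc a) b
  stepOut : ∀ {a b} → InPath T k a (suc b) → ¬ InT T a (suc b) →
            InPath T k (suc a) b

Critical : List ℕ → ℕ → ℕ → ℕ → Set
Critical T k a b =
  InPath T k a b × ¬ InT T a b ×
  ( (b ∸ height T a ≡ 0)
  ⊎ (0 < b ∸ height T a ×
     ∃[ a' ] ∃[ b' ] ( a < a' × InPath T k a' b' × InT T a' b'
                     × (∀ a'' b'' → a < a'' → a'' < a' → InPath T k a'' b'' → ¬ InT T a'' b'')
                     × b ∸ height T a ≤ suc b')))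

module Submission where

-- Write ω = evalWord w, σ = ω⁻¹ and rank p v = #{u < v : p ≤ ω u}; everything
-- about tower diagrams is translated into such counts.
--  * Inversions: if ω i < ω j then ℓ(ω t_{i,j}) = ℓ(ω) + 1 + 2·#{i<u<j : ω i < ω u < ω j},
--    so the length hypothesis means ω i < ω j with nothing "between" (cover).
--  * Towers: for a reduced word, tower p of towerOf w has height
--    #{u < σ p : p < ω u}; proved by following the sliding algorithm letter by letter.
--  * Flight numbers: fn T a b is the (b+1)-st position u with a ≤ ω u; hence tower s
--    has index σ s, and (a , b) is on the Schubert path of k iff rank a (k+1) = b+1.
-- Then i = σ s, the new tower s has height rank s j, and the path of k crosses
-- column s at height rank s (k+1) − 1, which gives (1) ⇔ (2). For criticality, the
-- path enters T at the least column a' > s with k < σ a', high enough by the cover.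

open import Data.Nat
open import Data.Nat.Properties
open import Data.Product
open import Data.Sum
open import Data.Empty
open import Data.Bool using (true; false; if_then_else_; T)
open import Data.Bool.Properties using (T-≡)
open import Data.Unit using (tt)
open import Relation.Nullary
open import Relation.Nullary.Decidable using (_×-dec_; ¬?)
open import Relation.Binary.PropositionalEquality hiding ([_])
open import Relation.Binary using (tri<; tri≈; tri>)
open import Data.List using (List; []; _∷_; _++_; [_]; replicate; length; foldl)
open import Data.List.Relation.Unary.All using (All; []; _∷_)
open import Data.Nat.Tactic.RingSolver
open import Function.Definitions using (Injective)
open import Algebra.Properties.CommutativeSemigroup +-commutativeSemigroup using (x∙yz≈y∙xz; xy∙z≈xz∙y)
open import Function.Bundles using (_⇔_; mk⇔; Equivalence)
open import Defs

ind : ∀ {A : Set} → Dec A → ℕ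
ind (yes _) = 1
ind (no _)  = 0

ind-yes : ∀ {A : Set} (d : Dec A) → A → ind d ≡ 1
ind-yes (yes _) _ = refl
ind-yes (no ¬a) a = ⊥-elim (¬a a)

ind-no : ∀ {A : Set} (d : Dec A) → ¬ A → ind d ≡ 0
ind-no (yes a) ¬a = ⊥-elim (¬a a)
ind-no (no _) _ = refl

ind-ext : ∀ {A B : Set} (d : Dec A) (e : Dec B) → (A → B) → (B → A) → ind d ≡ ind e
ind-ext (yes a) (yes b) f g = refl
ind-ext (yes a) (no ¬b) f g = ⊥-elim (¬b (f a))
ind-ext (no ¬a) (yes b) f g = ⊥-elim (¬a (g b))
ind-ext (no _) (no _) f g = refl

ind-≤ : ∀ {A B : Set} (d : Dec A) (e : Dec B) → (A → B) → ind d ≤ ind e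
ind-≤ (yes a) (yes b) f = ≤-refl
ind-≤ (yes a) (no ¬b) f = ⊥-elim (¬b (f a))
ind-≤ (no _) e f = z≤n

Pred : Set₁
Pred = ℕ → Set

DecP : Pred → Set
DecP P = ∀ u → Dec (P u)

cnt : {P : Pred} → DecP P → ℕ → ℕ
cnt P? zero = 0
cnt P? (suc n) = ind (P? n) + cnt P? n

cnt-ext : ∀ {P Q : Pred} (P? : DecP P) (Q? : DecP Q) n →
  (∀ u → u < n → P u → Q u) → (∀ u → u < n → Q u → P u) → cnt P? n ≡ cnt Q? n
cnt-ext P? Q? zero f g = refl
cnt-ext P? Q? (suc n) f g =
  cong₂ _+_ (ind-ext (P? n) (Q? n) (f n ≤-refl) (g n ≤-refl))
            (cnt-ext P? Q? n (λ u u<n → f u (m≤n⇒m≤1+n u<n)) (λ u u<n → g u (m≤n⇒m≤1+n u<n)))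

cnt-mono : ∀ {P Q : Pred} (P? : DecP P) (Q? : DecP Q) n →
  (∀ u → u < n → P u → Q u) → cnt P? n ≤ cnt Q? n
cnt-mono P? Q? zero f = z≤n
cnt-mono P? Q? (suc n) f =
  +-mono-≤ (ind-≤ (P? n) (Q? n) (f n ≤-refl)) (cnt-mono P? Q? n (λ u u<n → f u (m≤n⇒m≤1+n u<n)))

cnt-mono-bound : ∀ {P : Pred} (P? : DecP P) {m n} → m ≤ n → cnt P? m ≤ cnt P? n
cnt-mono-bound P? {m} {zero} z≤n = z≤n
cnt-mono-bound P? {m} {suc n} m≤sn with m≤n⇒m<n∨m≡n m≤sn
... | inj₂ refl = ≤-refl
... | inj₁ (s≤s m≤n) = ≤-trans (cnt-mono-bound P? m≤n) (m≤n+m _ _)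

cnt-zero : ∀ {P : Pred} (P? : DecP P) n → (∀ u → u < n → ¬ P u) → cnt P? n ≡ 0
cnt-zero P? zero f = refl
cnt-zero P? (suc n) f rewrite ind-no (P? n) (f n ≤-refl) = cnt-zero P? n (λ u u<n → f u (m≤n⇒m≤1+n u<n))

cnt-strict : ∀ {P : Pred} (P? : DecP P) u v → u < v → P u → suc (cnt P? u) ≤ cnt P? v
cnt-strict P? u v u<v pu =
  ≤-trans (≤-reflexive (cong (_+ cnt P? u) (sym (ind-yes (P? u) pu)))) (cnt-mono-bound P? u<v)

cnt-pos : ∀ {P : Pred} (P? : DecP P) n u → u < n → P u → 1 ≤ cnt P? n
cnt-pos P? n u u<n pu = ≤-trans (s≤s z≤n) (cnt-strict P? u n u<n pu)

cnt-point : ∀ {P : Pred} (P? : DecP P) c n → c < n →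
  cnt P? n ≡ cnt (λ u → P? u ×-dec ¬? (u ≟ c)) n + ind (P? c)
cnt-point P? c (suc n) c<sn with m≤n⇒m<n∨m≡n (s≤s⁻¹ c<sn)
... | inj₂ refl = begin
    ind (P? c) + cnt P? c
      ≡⟨ +-comm (ind (P? c)) _ ⟩
    cnt P? c + ind (P? c)
      ≡⟨ cong (_+ ind (P? c)) (cnt-ext P? Q? c (λ u u<c pu → pu , λ e → <-irrefl e u<c) (λ u _ → proj₁)) ⟩
    cnt Q? c + ind (P? c)
      ≡⟨ cong (λ z → z + cnt Q? c + ind (P? c)) (sym (ind-no (Q? c) (λ x → proj₂ x refl))) ⟩
    ind (Q? c) + cnt Q? c + ind (P? c) ∎
  where
  open ≡-Reasoning
  Q? = λ u → P? u ×-dec ¬? (u ≟ c)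
... | inj₁ c<n = begin
    ind (P? n) + cnt P? n
      ≡⟨ cong (ind (P? n) +_) (cnt-point P? c n c<n) ⟩
    ind (P? n) + (cnt Q? n + ind (P? c))
      ≡⟨ sym (+-assoc (ind (P? n)) _ _) ⟩
    ind (P? n) + cnt Q? n + ind (P? c)
      ≡⟨ cong (λ z → z + cnt Q? n + ind (P? c))
           (ind-ext (P? n) (Q? n) (λ pn → pn , λ e → <-irrefl (sym e) c<n) proj₁) ⟩
    ind (Q? n) + cnt Q? n + ind (P? c) ∎
  where
  open ≡-Reasoning
  Q? = λ u → P? u ×-dec ¬? (u ≟ c)

cnt-prefix : ∀ {P : Pred} (P? : DecP P) m n → m ≤ n →
  cnt P? n ≡ cnt P? m + cnt (λ u → (m ≤? u) ×-dec P? u) n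
cnt-prefix P? m zero z≤n = refl
cnt-prefix P? m (suc n) m≤sn with m≤n⇒m<n∨m≡n m≤sn
... | inj₂ refl = sym (trans (cong (cnt P? (suc n) +_)
                                   (cnt-zero _ (suc n) (λ u u<m x → <⇒≱ u<m (proj₁ x))))
                             (+-identityʳ _))
... | inj₁ (s≤s m≤n) = begin
    ind (P? n) + cnt P? n
      ≡⟨ cong (ind (P? n) +_) (cnt-prefix P? m n m≤n) ⟩
    ind (P? n) + (cnt P? m + cnt Q? n)
      ≡⟨ x∙yz≈y∙xz (ind (P? n)) (cnt P? m) (cnt Q? n) ⟩
    cnt P? m + (ind (P? n) + cnt Q? n)
      ≡⟨ cong (λ z → cnt P? m + (z + cnt Q? n)) (ind-ext (P? n) (Q? n) (λ pn → m≤n , pn) proj₂) ⟩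
    cnt P? m + (ind (Q? n) + cnt Q? n) ∎
  where
  open ≡-Reasoning
  Q? = λ u → (m ≤? u) ×-dec P? u

cnt-swap : ∀ {P : Pred} (P? : DecP P) (t : ℕ → ℕ) i j n → i < j → j < n →
  t i ≡ j → t j ≡ i → (∀ u → u ≢ i → u ≢ j → t u ≡ u) →
  cnt (λ u → P? (t u)) n ≡ cnt P? n
cnt-swap {P} P? t i j n i<j j<n ti tj tu = begin
    cnt P?t n
      ≡⟨ cnt-point P?t i n (<-trans i<j j<n) ⟩
    cnt A n + ind (P? (t i))
      ≡⟨ cong (_+ ind (P? (t i))) (cnt-point A j n j<n) ⟩
    cnt (λ u → A u ×-dec ¬? (u ≟ j)) n + ind (A j) + ind (P? (t i))
      ≡⟨ cong₂ (λ x y → x + y + ind (P? (t i))) away-from-i-j at-j ⟩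
    cnt (λ u → B u ×-dec ¬? (u ≟ i)) n + ind (P? i) + ind (P? (t i))
      ≡⟨ cong (λ z → cnt (λ u → B u ×-dec ¬? (u ≟ i)) n + ind (P? i) + ind (P? z)) ti ⟩
    cnt (λ u → B u ×-dec ¬? (u ≟ i)) n + ind (P? i) + ind (P? j)
      ≡⟨ cong (λ z → cnt (λ u → B u ×-dec ¬? (u ≟ i)) n + z + ind (P? j))
              (ind-ext (P? i) (B i) (λ p → p , i≢j) proj₁) ⟩
    cnt (λ u → B u ×-dec ¬? (u ≟ i)) n + ind (B i) + ind (P? j)
      ≡⟨ cong (_+ ind (P? j)) (sym (cnt-point B i n (<-trans i<j j<n))) ⟩
    cnt B n + ind (P? j)
      ≡⟨ sym (cnt-point P? j n j<n) ⟩
    cnt P? n ∎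
  where
  open ≡-Reasoning
  P?t : DecP (λ u → P (t u))
  P?t u = P? (t u)
  A = λ u → P?t u ×-dec ¬? (u ≟ i)
  B = λ u → P? u ×-dec ¬? (u ≟ j)
  i≢j : i ≢ j
  i≢j = <⇒≢ i<j
  away-from-i-j : cnt (λ u → A u ×-dec ¬? (u ≟ j)) n ≡ cnt (λ u → B u ×-dec ¬? (u ≟ i)) n
  away-from-i-j = cnt-ext _ _ n
    (λ u _ ((p , u≢i) , u≢j) → (subst P (tu u u≢i u≢j) p , u≢j) , u≢i)
    (λ u _ ((p , u≢j) , u≢i) → (subst P (sym (tu u u≢i u≢j)) p , u≢i) , u≢j)
  at-j : ind (A j) ≡ ind (P? i)
  at-j = ind-ext (A j) (P? i) (λ x → subst P tj (proj₁ x)) (λ pi → subst P (sym tj) pi , λ e → i≢j (sym e))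

cnt-lin : ∀ {P Q R S B : Pred} (P? : DecP P) (Q? : DecP Q) (R? : DecP R) (S? : DecP S) (B? : DecP B) n →
  (∀ u → u < n → ind (P? u) + ind (Q? u) ≡ ind (R? u) + ind (S? u) + 2 * ind (B? u)) →
  cnt P? n + cnt Q? n ≡ cnt R? n + cnt S? n + 2 * cnt B? n
cnt-lin P? Q? R? S? B? zero h = refl
cnt-lin P? Q? R? S? B? (suc n) h = begin
    (ind (P? n) + cnt P? n) + (ind (Q? n) + cnt Q? n)
      ≡⟨ regroup₁ (ind (P? n)) (cnt P? n) (ind (Q? n)) (cnt Q? n) ⟩
    (ind (P? n) + ind (Q? n)) + (cnt P? n + cnt Q? n)
      ≡⟨ cong₂ _+_ (h n ≤-refl) (cnt-lin P? Q? R? S? B? n (λ u u<n → h u (m≤n⇒m≤1+n u<n))) ⟩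
    (ind (R? n) + ind (S? n) + 2 * ind (B? n)) + (cnt R? n + cnt S? n + 2 * cnt B? n)
      ≡⟨ regroup₂ (ind (R? n)) (ind (S? n)) (ind (B? n)) (cnt R? n) (cnt S? n) (cnt B? n) ⟩
    (ind (R? n) + cnt R? n) + (ind (S? n) + cnt S? n) + 2 * (ind (B? n) + cnt B? n) ∎
  where
  open ≡-Reasoning
  regroup₁ : ∀ a b c d → (a + b) + (c + d) ≡ (a + c) + (b + d)
  regroup₁ = solve-∀
  regroup₂ : ∀ a b c d e f → (a + b + 2 * c) + (d + e + 2 * f) ≡ (a + d) + (b + e) + 2 * (c + f)
  regroup₂ = solve-∀

split-at : ∀ {P : Pred} (P? : DecP P) i j → i < j →
  cnt (λ u → P? u ×-dec ¬? (u ≟ i)) j ≡ cnt P? i + cnt (λ u → (i <? u) ×-dec P? u) j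
split-at P? i j i<j = trans (cnt-prefix _ i j (<⇒≤ i<j))
  (cong₂ _+_ (cnt-ext _ _ i (λ u _ → proj₁) (λ u u<i p → p , λ e → <-irrefl e u<i))
             (cnt-ext _ _ j (λ u _ (i≤u , p , u≢i) → ≤∧≢⇒< i≤u (λ e → u≢i (sym e)) , p)
                            (λ u _ (i<u , p) → <⇒≤ i<u , p , λ e → <-irrefl (sym e) i<u)))

-- Inversions and transpositions (positions counted from 0 here)

Row : (ℕ → ℕ) → ℕ → ℕ
Row F y = cnt (λ u → F y <? F u) y

Inv : (ℕ → ℕ) → ℕ → ℕ
Inv F zero = 0
Inv F (suc y) = Row F y + Inv F y

Row-ext : ∀ F G y → (∀ u → F u ≡ G u) → Row F y ≡ Row G y
Row-ext F G y e = cnt-ext _ _ y (λ u _ p → subst₂ _<_ (e y) (e u) p)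
                                (λ u _ p → subst₂ _<_ (sym (e y)) (sym (e u)) p)

Inv-ext : ∀ F G N → (∀ u → F u ≡ G u) → Inv F N ≡ Inv G N
Inv-ext F G zero e = refl
Inv-ext F G (suc N) e = cong₂ _+_ (Row-ext F G N e) (Inv-ext F G N e)

-- #{i < u < j : F i < F u < F j}, the obstruction to a Bruhat cover
between : (ℕ → ℕ) → ℕ → ℕ → ℕ
between F i j = cnt (λ u → (i <? u) ×-dec ((F i <? F u) ×-dec (F u <? F j))) j

-- The rows of G and F agree outside [i, j]; the rows i … j are compared through
-- the auxiliary counts below, which telescope.
module TranspositionInversions (F G t : ℕ → ℕ) (i j : ℕ) (i<j : i < j)
          (Finj : Injective _≡_ _≡_ F) (Fi<Fj : F i < F j)
          (ti : t i ≡ j) (tj : t j ≡ i) (tu : ∀ u → u ≢ i → u ≢ j → t u ≡ u)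
          (Ge : ∀ u → G u ≡ F (t u)) where

  open ≡-Reasoning

  Ai = cnt (λ u → F i <? F u) i
  Aj = cnt (λ u → F j <? F u) i
  Bi = cnt (λ u → (i <? u) ×-dec (F i <? F u)) j
  Bj = cnt (λ u → (i <? u) ×-dec (F j <? F u)) j
  S1 = λ N → cnt (λ y → (i <? y) ×-dec (F y <? F i)) N
  S2 = λ N → cnt (λ y → (i <? y) ×-dec (F y <? F j)) N

  Gi : G i ≡ F j
  Gi = trans (Ge i) (cong F ti)
  Gj : G j ≡ F i
  Gj = trans (Ge j) (cong F tj)
  Gu : ∀ u → u ≢ i → u ≢ j → G u ≡ F u
  Gu u u≢i u≢j = trans (Ge u) (cong F (tu u u≢i u≢j))

  G≡F-before : ∀ {u} → u < i → G u ≡ F u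
  G≡F-before u<i = Gu _ (<⇒≢ u<i) (<⇒≢ (<-trans u<i i<j))

  row-before : ∀ y → y < i → Row G y ≡ Row F y
  row-before y y<i = cnt-ext _ _ y
    (λ u u<y → subst₂ _<_ (G≡F-before y<i) (G≡F-before (<-trans u<y y<i)))
    (λ u u<y → subst₂ _<_ (sym (G≡F-before y<i)) (sym (G≡F-before (<-trans u<y y<i))))

  row-after : ∀ y → j < y → Row G y ≡ Row F y
  row-after y j<y = trans (cnt-ext _ _ y (λ u _ → subst₂ _<_ Gy (Ge u)) (λ u _ → subst₂ _<_ (sym Gy) (sym (Ge u))))
                          (cnt-swap (λ v → F y <? F v) t i j y i<j j<y ti tj tu)
    where
    Gy : G y ≡ F y
    Gy = Gu y (λ e → <-irrefl (sym e) (<-trans i<j j<y)) (λ e → <-irrefl (sym e) j<y)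

  row-i : Row G i ≡ Aj
  row-i = cnt-ext _ _ i (λ u u<i → subst₂ _<_ Gi (G≡F-before u<i))
                        (λ u u<i → subst₂ _<_ (sym Gi) (sym (G≡F-before u<i)))

  row-mid : ∀ y → i < y → y < j → Row G y + ind (F y <? F i) ≡ Row F y + ind (F y <? F j)
  row-mid y i<y y<j = begin
      Row G y + ind (F y <? F i)
        ≡⟨ cong (_+ ind (F y <? F i)) RowG ⟩
      cnt Q? y + ind (F y <? F j) + ind (F y <? F i)
        ≡⟨ xy∙z≈xz∙y (cnt Q? y) (ind (F y <? F j)) (ind (F y <? F i)) ⟩
      cnt Q? y + ind (F y <? F i) + ind (F y <? F j)
        ≡⟨ cong (_+ ind (F y <? F j)) (sym (cnt-point (λ u → F y <? F u) i y i<y)) ⟩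
      Row F y + ind (F y <? F j) ∎
    where
    Q? = λ u → (F y <? F u) ×-dec ¬? (u ≟ i)
    Gy : G y ≡ F y
    Gy = Gu y (λ e → <-irrefl (sym e) i<y) (<⇒≢ y<j)
    RowG : Row G y ≡ cnt Q? y + ind (F y <? F j)
    RowG = begin
      Row G y
        ≡⟨ cnt-ext _ (λ u → F y <? F (t u)) y (λ u _ → subst₂ _<_ Gy (Ge u)) (λ u _ → subst₂ _<_ (sym Gy) (sym (Ge u))) ⟩
      cnt (λ u → F y <? F (t u)) y
        ≡⟨ cnt-point (λ u → F y <? F (t u)) i y i<y ⟩
      cnt (λ u → (F y <? F (t u)) ×-dec ¬? (u ≟ i)) y + ind (F y <? F (t i))
        ≡⟨ cong₂ _+_ (cnt-ext _ _ y
               (λ u u<y (p , u≢i) → subst (F y <_) (cong F (tu u u≢i (<⇒≢ (<-trans u<y y<j)))) p , u≢i)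
               (λ u u<y (p , u≢i) → subst (F y <_) (cong F (sym (tu u u≢i (<⇒≢ (<-trans u<y y<j))))) p , u≢i))
             (ind-ext (F y <? F (t i)) (F y <? F j) (subst (λ z → F y < F z) ti) (subst (λ z → F y < F z) (sym ti))) ⟩
      cnt Q? y + ind (F y <? F j) ∎

  row-j : Row G j + Aj + Bj ≡ Row F j + Ai + Bi + 1
  row-j = begin
      Row G j + Aj + Bj
        ≡⟨ cong (λ z → z + Aj + Bj) RowG ⟩
      (Ai + Bi + 1) + Aj + Bj
        ≡⟨ regroup Ai Bi Aj Bj ⟩
      (Aj + Bj) + Ai + Bi + 1
        ≡⟨ cong (λ z → z + Ai + Bi + 1) (sym RowF) ⟩
      Row F j + Ai + Bi + 1 ∎
    where
    regroup : ∀ a b c d → (a + b + 1) + c + d ≡ (c + d) + a + b + 1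
    regroup = solve-∀
    RowG : Row G j ≡ Ai + Bi + 1
    RowG = begin
      Row G j
        ≡⟨ cnt-ext _ (λ u → F i <? F (t u)) j (λ u _ → subst₂ _<_ Gj (Ge u)) (λ u _ → subst₂ _<_ (sym Gj) (sym (Ge u))) ⟩
      cnt (λ u → F i <? F (t u)) j
        ≡⟨ cnt-point (λ u → F i <? F (t u)) i j i<j ⟩
      cnt (λ u → (F i <? F (t u)) ×-dec ¬? (u ≟ i)) j + ind (F i <? F (t i))
        ≡⟨ cong₂ _+_ (cnt-ext _ (λ u → (F i <? F u) ×-dec ¬? (u ≟ i)) j
               (λ u u<j (p , u≢i) → subst (F i <_) (cong F (tu u u≢i (<⇒≢ u<j))) p , u≢i)
               (λ u u<j (p , u≢i) → subst (F i <_) (cong F (sym (tu u u≢i (<⇒≢ u<j)))) p , u≢i))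
             (ind-yes (F i <? F (t i)) (subst (λ z → F i < F z) (sym ti) Fi<Fj)) ⟩
      cnt (λ u → (F i <? F u) ×-dec ¬? (u ≟ i)) j + 1
        ≡⟨ cong (_+ 1) (split-at (λ u → F i <? F u) i j i<j) ⟩
      Ai + Bi + 1 ∎
    RowF : Row F j ≡ Aj + Bj
    RowF = begin
      Row F j
        ≡⟨ cnt-point (λ u → F j <? F u) i j i<j ⟩
      cnt (λ u → (F j <? F u) ×-dec ¬? (u ≟ i)) j + ind (F j <? F i)
        ≡⟨ cong₂ _+_ (split-at (λ u → F j <? F u) i j i<j) (ind-no (F j <? F i) (<⇒≯ Fi<Fj)) ⟩
      Aj + Bj + 0
        ≡⟨ +-identityʳ _ ⟩
      Aj + Bj ∎

  inv-upto-i : ∀ N → N ≤ i → Inv G N ≡ Inv F N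
  inv-upto-i zero _ = refl
  inv-upto-i (suc N) sN≤i = cong₂ _+_ (row-before N sN≤i) (inv-upto-i N (≤-trans (n≤1+n N) sN≤i))

  inv-upto-j : ∀ d → d + suc i ≤ j →
    Inv G (d + suc i) + Ai + S1 (d + suc i) ≡ Inv F (d + suc i) + Aj + S2 (d + suc i)
  inv-upto-j zero _ = begin
      Row G i + Inv G i + Ai + S1 (suc i)
        ≡⟨ cong₂ (λ a b → a + b + Ai + S1 (suc i)) row-i (inv-upto-i i ≤-refl) ⟩
      Aj + Inv F i + Ai + S1 (suc i)
        ≡⟨ cong₂ (λ a b → Aj + Inv F i + Ai + a) (none-up-to-i (λ y → F y <? F i)) (none-up-to-i (λ y → F y <? F j)) ⟩
      Aj + Inv F i + Ai + 0
        ≡⟨ regroup Aj (Inv F i) Ai ⟩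
      Ai + Inv F i + Aj + 0
        ≡⟨ cong (λ a → Ai + Inv F i + Aj + a) (sym (none-up-to-i (λ y → F y <? F j))) ⟩
      Row F i + Inv F i + Aj + S2 (suc i) ∎
    where
    regroup : ∀ a b c → a + b + c + 0 ≡ c + b + a + 0
    regroup = solve-∀
    none-up-to-i : ∀ {Q : Pred} (Q? : DecP Q) → cnt (λ y → (i <? y) ×-dec Q? y) (suc i) ≡ 0
    none-up-to-i Q? = cnt-zero _ (suc i) (λ u u≤i x → <⇒≱ (proj₁ x) (s≤s⁻¹ u≤i))
  inv-upto-j (suc d) N<j = begin
      Row G N + Inv G N + Ai + (ind (Q1 N) + S1 N)
        ≡⟨ regroup (Row G N) (Inv G N) Ai (ind (Q1 N)) (S1 N) ⟩
      (Row G N + ind (Q1 N)) + (Inv G N + Ai + S1 N)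
        ≡⟨ cong₂ _+_ (trans (cong (Row G N +_) (ind-ext (Q1 N) (F N <? F i) proj₂ (λ p → i<N , p))) (row-mid N i<N N<j))
                     (inv-upto-j d (<⇒≤ N<j)) ⟩
      (Row F N + ind (F N <? F j)) + (Inv F N + Aj + S2 N)
        ≡⟨ cong (λ z → (Row F N + z) + (Inv F N + Aj + S2 N)) (ind-ext (F N <? F j) (Q2 N) (λ p → i<N , p) proj₂) ⟩
      (Row F N + ind (Q2 N)) + (Inv F N + Aj + S2 N)
        ≡⟨ sym (regroup (Row F N) (Inv F N) Aj (ind (Q2 N)) (S2 N)) ⟩
      Row F N + Inv F N + Aj + (ind (Q2 N) + S2 N) ∎
    where
    N = d + suc i
    Q1 = λ y → (i <? y) ×-dec (F y <? F i)
    Q2 = λ y → (i <? y) ×-dec (F y <? F j)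
    i<N : i < N
    i<N = m≤n+m (suc i) d
    regroup : ∀ a b c d e → a + b + c + (d + e) ≡ (a + d) + (b + c + e)
    regroup = solve-∀

  inv-at-j : Inv G j + Ai + S1 j ≡ Inv F j + Aj + S2 j
  inv-at-j = subst (λ N → Inv G N + Ai + S1 N ≡ Inv F N + Aj + S2 N) (m∸n+n≡m i<j)
                   (inv-upto-j (j ∸ suc i) (≤-reflexive (m∸n+n≡m i<j)))

  inv-after-j : ∀ d → Inv G (d + suc j) + (Ai + S1 j + Aj + Bj) ≡ Inv F (d + suc j) + (Aj + S2 j + Ai + Bi + 1)
  inv-after-j zero = begin
      Row G j + Inv G j + (Ai + S1 j + Aj + Bj)
        ≡⟨ regroup₁ (Row G j) (Inv G j) Ai (S1 j) Aj Bj ⟩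
      (Row G j + Aj + Bj) + (Inv G j + Ai + S1 j)
        ≡⟨ cong₂ _+_ row-j inv-at-j ⟩
      (Row F j + Ai + Bi + 1) + (Inv F j + Aj + S2 j)
        ≡⟨ regroup₂ (Row F j) Ai Bi (Inv F j) Aj (S2 j) ⟩
      Row F j + Inv F j + (Aj + S2 j + Ai + Bi + 1) ∎
    where
    regroup₁ : ∀ a b c d e f → a + b + (c + d + e + f) ≡ (a + e + f) + (b + c + d)
    regroup₁ = solve-∀
    regroup₂ : ∀ a b c d e f → (a + b + c + 1) + (d + e + f) ≡ a + d + (e + f + b + c + 1)
    regroup₂ = solve-∀
  inv-after-j (suc d) = begin
      Row G M + Inv G M + X
        ≡⟨ +-assoc (Row G M) _ _ ⟩
      Row G M + (Inv G M + X)
        ≡⟨ cong₂ _+_ (row-after M (m≤n+m (suc j) d)) (inv-after-j d) ⟩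
      Row F M + (Inv F M + Y)
        ≡⟨ sym (+-assoc (Row F M) _ _) ⟩
      Row F M + Inv F M + Y ∎
    where
    M = d + suc j
    X = Ai + S1 j + Aj + Bj
    Y = Aj + S2 j + Ai + Bi + 1

  between-balance : S2 j + Bi ≡ S1 j + Bj + 2 * between F i j
  between-balance = cnt-lin _ _ _ _ _ j pointwise
    where
    pointwise : ∀ u → u < j → ind ((i <? u) ×-dec (F u <? F j)) + ind ((i <? u) ×-dec (F i <? F u))
           ≡ ind ((i <? u) ×-dec (F u <? F i)) + ind ((i <? u) ×-dec (F j <? F u))
             + 2 * ind ((i <? u) ×-dec ((F i <? F u) ×-dec (F u <? F j)))
    pointwise u u<j with i <? u
    ... | no _ = refl
    ... | yes i<u with F u <? F i | F i <? F u | F u <? F j | F j <? F u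
    ... | yes a | yes b | _ | _ = ⊥-elim (<-asym a b)
    ... | _ | _ | yes a | yes b = ⊥-elim (<-asym a b)
    ... | no a | no b | _ | _ = ⊥-elim (a (≤∧≢⇒< (≮⇒≥ b) (λ e → <-irrefl (sym (Finj e)) i<u)))
    ... | _ | _ | no a | no b = ⊥-elim (a (≤∧≢⇒< (≮⇒≥ b) (λ e → <-irrefl (Finj e) u<j)))
    ... | yes a | no _ | yes _ | no _ = refl
    ... | yes a | no _ | no _ | yes b = ⊥-elim (<-asym a (<-trans Fi<Fj b))
    ... | no _ | yes _ | yes _ | no _ = refl
    ... | no _ | yes _ | no _ | yes _ = refl

  inv-transposition : ∀ N → j < N → Inv G N ≡ suc (Inv F N + 2 * between F i j)
  inv-transposition N j<N = +-cancelʳ-≡ (Ai + S1 j + Aj + Bj) _ _ (begin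
      Inv G N + (Ai + S1 j + Aj + Bj)
        ≡⟨ subst (λ M → Inv G M + (Ai + S1 j + Aj + Bj) ≡ Inv F M + (Aj + S2 j + Ai + Bi + 1))
                 (m∸n+n≡m j<N) (inv-after-j (N ∸ suc j)) ⟩
      Inv F N + (Aj + S2 j + Ai + Bi + 1)
        ≡⟨ cong (Inv F N +_) (regroup₁ Aj (S2 j) Ai Bi) ⟩
      Inv F N + (Aj + Ai + 1 + (S2 j + Bi))
        ≡⟨ cong (λ z → Inv F N + (Aj + Ai + 1 + z)) between-balance ⟩
      Inv F N + (Aj + Ai + 1 + (S1 j + Bj + 2 * between F i j))
        ≡⟨ regroup₂ (Inv F N) Aj Ai (S1 j) Bj (between F i j) ⟩
      suc (Inv F N + 2 * between F i j) + (Ai + S1 j + Aj + Bj) ∎)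
    where
    regroup₁ : ∀ a b c d → a + b + c + d + 1 ≡ a + c + 1 + (b + d)
    regroup₁ = solve-∀
    regroup₂ : ∀ n a c s b t → n + (a + c + 1 + (s + b + 2 * t)) ≡ suc (n + 2 * t) + (c + s + a + b)
    regroup₂ = solve-∀

≡ᵇ-view : ∀ x a → (x ≡ a × (x ≡ᵇ a) ≡ true) ⊎ (x ≢ a × (x ≡ᵇ a) ≡ false)
≡ᵇ-view x a with x ≡ᵇ a in eq
... | true = inj₁ (≡ᵇ⇒≡ x a (subst T (sym eq) tt) , refl)
... | false = inj₂ ((λ e → subst T eq (≡⇒≡ᵇ x a e)) , refl)

transp-a : ∀ a b → transp a b a ≡ b
transp-a a b with ≡ᵇ-view a a
... | inj₁ (_ , e) rewrite e = refl
... | inj₂ (ne , _) = ⊥-elim (ne refl)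

transp-b : ∀ a b → transp a b b ≡ a
transp-b a b with ≡ᵇ-view b a
... | inj₁ (refl , _) = transp-a b b
... | inj₂ (_ , e) rewrite e with ≡ᵇ-view b b
...   | inj₁ (_ , e') rewrite e' = refl
...   | inj₂ (ne , _) = ⊥-elim (ne refl)

transp-o : ∀ a b x → x ≢ a → x ≢ b → transp a b x ≡ x
transp-o a b x na nb with ≡ᵇ-view x a
... | inj₁ (e , _) = ⊥-elim (na e)
... | inj₂ (_ , e) rewrite e with ≡ᵇ-view x b
...   | inj₁ (e' , _) = ⊥-elim (nb e')
...   | inj₂ (_ , e') rewrite e' = refl

transp-inv : ∀ a b x → transp a b (transp a b x) ≡ x
transp-inv a b x with x ≟ a | x ≟ b
... | yes refl | _ = trans (cong (transp x b) (transp-a x b)) (transp-b x b)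
... | no _ | yes refl = trans (cong (transp a x) (transp-b a x)) (transp-a a x)
... | no na | no nb = trans (cong (transp a b) (transp-o a b x na nb)) (transp-o a b x na nb)

transp-suc : ∀ a b x → transp (suc a) (suc b) (suc x) ≡ suc (transp a b x)
transp-suc a b x with x ≟ a | x ≟ b
... | yes refl | _ = trans (transp-a (suc x) (suc b)) (cong suc (sym (transp-a x b)))
... | no _ | yes refl = trans (transp-b (suc a) (suc x)) (cong suc (sym (transp-b a x)))
... | no na | no nb = trans (transp-o (suc a) (suc b) (suc x) (λ e → na (suc-injective e)) (λ e → nb (suc-injective e)))
                             (cong suc (sym (transp-o a b x na nb)))

transp-injective : ∀ a b (f : ℕ → ℕ) → Injective _≡_ _≡_ f → Injective _≡_ _≡_ (λ x → f (transp a b x))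
transp-injective a b f finj {x} {y} e = trans (sym (transp-inv a b x)) (trans (cong (transp a b) (finj e)) (transp-inv a b y))

bool-ind : ∀ {A : Set} (d : Dec A) → (if does d then 1 else 0) ≡ ind d
bool-ind (yes _) = refl
bool-ind (no _) = refl

countAbove≡cnt : ∀ f y x → countAbove f y x ≡ cnt (λ u → f y <? f (suc u)) x
countAbove≡cnt f y zero = refl
countAbove≡cnt f y (suc x) = cong₂ _+_ (bool-ind (f y <? f (suc x))) (countAbove≡cnt f y x)

-- inv counts from position 1, Inv from position 0
inv≡Inv : ∀ f N → inv f N ≡ Inv (λ u → f (suc u)) N
inv≡Inv f zero = refl
inv≡Inv f (suc N) = cong₂ _+_ (countAbove≡cnt f (suc N) N) (inv≡Inv f N)

-- the transposition t_{i+1,j+1} with i < j < N, seen from position 0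
module ShiftedTransposition (f : ℕ → ℕ) (finj : Injective _≡_ _≡_ f) (i j N : ℕ) (i<j : i < j) (j<N : j < N) where
  t = transp i j
  F = λ u → f (suc u)
  G = λ u → F (t u)

  Finj : Injective _≡_ _≡_ F
  Finj e = suc-injective (finj e)

  invG : inv (λ x → f (transp (suc i) (suc j) x)) N ≡ Inv G N
  invG = trans (inv≡Inv _ N) (Inv-ext _ _ N (λ u → cong f (transp-suc i j u)))

  up : f (suc i) < f (suc j) →
    inv (λ x → f (transp (suc i) (suc j) x)) N ≡ suc (inv f N + 2 * between F i j)
  up lt = trans invG (trans (TranspositionInversions.inv-transposition F G t i j i<j Finj lt
                               (transp-a i j) (transp-b i j) (transp-o i j) (λ u → refl) N j<N)
                            (cong (λ z → suc (z + 2 * between F i j)) (sym (inv≡Inv f N))))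

  down : f (suc j) < f (suc i) →
    inv f N ≡ suc (inv (λ x → f (transp (suc i) (suc j) x)) N + 2 * between G i j)
  down lt = trans (inv≡Inv f N)
    (trans (TranspositionInversions.inv-transposition G F t i j i<j (transp-injective i j F Finj)
              (subst₂ _<_ (sym (cong F (transp-a i j))) (sym (cong F (transp-b i j))) lt)
              (transp-a i j) (transp-b i j) (transp-o i j) (λ u → cong F (sym (transp-inv i j u))) N j<N)
           (cong (λ z → suc (z + 2 * between G i j)) (sym invG)))

cover : ∀ f → Injective _≡_ _≡_ f → ∀ i j N → 1 ≤ i → i < j → j ≤ N →
  inv (λ x → f (transp i j x)) N ≡ suc (inv f N) →
  f i < f j × (∀ x → i < x → x < j → f i < f x → f x < f j → ⊥)
cover f finj (suc i) (suc j) N _ (s≤s i<j) j<N h with <-cmp (f (suc i)) (f (suc j))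
... | tri≈ _ e _ = ⊥-elim (<-irrefl (finj e) (s≤s i<j))
... | tri> _ _ gt = ⊥-elim (1+n≰n (begin
      suc (inv f N)                            ≤⟨ n≤1+n _ ⟩
      suc (suc (inv f N))                      ≡⟨ cong suc (sym h) ⟩
      suc (inv (λ x → f (transp (suc i) (suc j) x)) N) ≤⟨ s≤s (m≤m+n _ _) ⟩
      suc (inv (λ x → f (transp (suc i) (suc j) x)) N + _)
                                               ≡⟨ sym (down gt) ⟩
      inv f N                                  ∎))
  where
  open ≤-Reasoning
  open ShiftedTransposition f finj i j N i<j j<N
... | tri< lt _ _ = lt , nothing-between
  where
  open ShiftedTransposition f finj i j N i<j j<N
  none : between F i j ≡ 0
  none = *-cancelˡ-≡ _ 0 2 (+-cancelˡ-≡ (inv f N) _ _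
           (trans (suc-injective (trans (sym (up lt)) h)) (sym (+-identityʳ _))))
  nothing-between : ∀ x → suc i < x → x < suc j → f (suc i) < f x → f x < f (suc j) → ⊥
  nothing-between (suc x) (s≤s i<x) (s≤s x<j) a b =
    <-irrefl (sym none) (cnt-pos _ j x x<j (i<x , a , b))

between-adjacent : ∀ H a → between H a (suc a) ≡ 0
between-adjacent H a = cnt-zero _ (suc a) (λ u u≤a x → <⇒≱ (proj₁ x) (s≤s⁻¹ u≤a))

adjacent : ∀ f → Injective _≡_ _≡_ f → ∀ a N → 1 ≤ a → suc a ≤ N →
  (f a < f (suc a) × inv (λ x → f (sgen a x)) N ≡ suc (inv f N))
  ⊎ (f (suc a) < f a × inv f N ≡ suc (inv (λ x → f (sgen a x)) N))
adjacent f finj (suc a) N _ saN with <-cmp (f (suc a)) (f (suc (suc a)))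
... | tri≈ _ e _ = ⊥-elim (<-irrefl (finj e) (n<1+n (suc a)))
... | tri< lt _ _ = inj₁ (lt , trans (up lt)
        (cong suc (trans (cong (λ z → inv f N + 2 * z) (between-adjacent F a)) (+-identityʳ _))))
  where open ShiftedTransposition f finj a (suc a) N (n<1+n a) saN
... | tri> _ _ gt = inj₂ (gt , trans (down gt)
        (cong suc (trans (cong (λ z → inv (λ x → f (sgen (suc a) x)) N + 2 * z) (between-adjacent G a)) (+-identityʳ _))))
  where open ShiftedTransposition f finj a (suc a) N (n<1+n a) saN

-- Tower heights as counts

-- height of tower q in a list of towers whose first entry is tower p
hAt : ℕ → List ℕ → ℕ → ℕ
hAt p [] q = 0
hAt p (h ∷ L) q with q ≟ p
... | yes _ = h
... | no _ = hAt (suc p) L q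

hAt-here : ∀ p h L → hAt p (h ∷ L) p ≡ h
hAt-here p h L with p ≟ p
... | yes _ = refl
... | no ne = ⊥-elim (ne refl)

hAt-there : ∀ p h L q → q ≢ p → hAt p (h ∷ L) q ≡ hAt (suc p) L q
hAt-there p h L q ne with q ≟ p
... | yes e = ⊥-elim (ne e)
... | no _ = refl

hAt-shift : ∀ p L q → hAt (suc p) L (suc q) ≡ hAt p L q
hAt-shift p [] q = refl
hAt-shift p (h ∷ L) q with q ≟ p
... | yes refl = hAt-here (suc q) h L
... | no ne = trans (hAt-there (suc p) h L (suc q) (λ e → ne (suc-injective e))) (hAt-shift (suc p) L q)

height≡hAt : ∀ T q → 1 ≤ q → height T q ≡ hAt 1 T q
height≡hAt [] q _ = refl
height≡hAt (h ∷ L) (suc zero) _ = sym (hAt-here 1 h L)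
height≡hAt (h ∷ L) (suc (suc q)) _ =
  trans (height≡hAt L (suc q) (s≤s z≤n))
        (trans (sym (hAt-shift 1 L (suc q))) (sym (hAt-there 1 h L (suc (suc q)) λ ())))

hAt-single : ∀ n p q → hAt p (replicate n 0 ++ [ 1 ]) q ≡ ind (q ≟ p + n)
hAt-single zero p q rewrite +-identityʳ p with q ≟ p
... | yes _ = refl
... | no _ = refl
hAt-single (suc n) p q with q ≟ p
... | yes refl = sym (ind-no (q ≟ q + suc n) (λ e → <-irrefl e (m<m+n q z<s)))
... | no ne = trans (hAt-single n (suc p) q)
                    (ind-ext (q ≟ suc p + n) (q ≟ p + suc n) (λ e → trans e (sym (+-suc p n))) (λ e → trans e (+-suc p n)))

module Ranks (ω σ : ℕ → ℕ) (σω : ∀ x → σ (ω x) ≡ x) (ωσ : ∀ x → ω (σ x) ≡ x) (ω0 : ω 0 ≡ 0) where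

  ωinj : Injective _≡_ _≡_ ω
  ωinj {x} {y} e = trans (sym (σω x)) (trans (cong σ e) (σω y))

  ω≡⇒σ : ∀ {u p} → ω u ≡ p → u ≡ σ p
  ω≡⇒σ {u} e = trans (sym (σω u)) (cong σ e)

  rank : ℕ → ℕ → ℕ
  rank p v = cnt (λ u → p ≤? ω u) v

  -- the expected height of tower p: #{u < σ p : p < ω u}
  code : ℕ → ℕ
  code p = cnt (λ u → p <? ω u) (σ p)

  code≡rank : ∀ p → code p ≡ rank p (σ p)
  code≡rank p = cnt-ext _ _ (σ p) (λ u _ → <⇒≤)
    (λ u u<σp le → ≤∧≢⇒< le (λ e → <-irrefl (ω≡⇒σ (sym e)) u<σp))

  rank-strict : ∀ p {u v} → u < v → p ≤ ω u → suc (rank p u) ≤ rank p v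
  rank-strict p {u} {v} u<v fr = cnt-strict (λ u → p ≤? ω u) u v u<v fr

  rank-mono : ∀ p {u v} → u ≤ v → rank p u ≤ rank p v
  rank-mono p u≤v = cnt-mono-bound (λ u → p ≤? ω u) u≤v

  rank-<⇒< : ∀ p {u v} → rank p u < rank p v → u < v
  rank-<⇒< p {u} {v} lt with <-cmp u v
  ... | tri< x _ _ = x
  ... | tri≈ _ e _ = ⊥-elim (<-irrefl (cong (rank p) e) lt)
  ... | tri> _ _ gt = ⊥-elim (<⇒≱ lt (rank-mono p (<⇒≤ gt)))

  rank-inj : ∀ p {u v} → p ≤ ω u → p ≤ ω v → rank p u ≡ rank p v → u ≡ v
  rank-inj p {u} {v} fu fv e with <-cmp u v
  ... | tri< u<v _ _ = ⊥-elim (<-irrefl e (rank-strict p u<v fu))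
  ... | tri≈ _ u≡v _ = u≡v
  ... | tri> _ _ v<u = ⊥-elim (<-irrefl (sym e) (rank-strict p v<u fv))

  rank-past-σ : ∀ p v → σ p < v → rank p v ≡ suc (rank (suc p) v)
  rank-past-σ p v σp<v = trans (cnt-point (λ u → p ≤? ω u) (σ p) v σp<v)
     (trans (cong₂ _+_ (cnt-ext _ _ v (λ u _ (p≤ωu , u≢σp) → ≤∧≢⇒< p≤ωu (λ e → u≢σp (ω≡⇒σ (sym e))))
                                       (λ u _ p<ωu → <⇒≤ p<ωu , λ e → <-irrefl (trans (sym (ωσ p)) (sym (cong ω e))) p<ωu))
                       (ind-yes (p ≤? ω (σ p)) (≤-reflexive (sym (ωσ p)))))
            (+-comm _ 1))

  rank-upto-σ : ∀ p v → v ≤ σ p → rank p v ≡ rank (suc p) v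
  rank-upto-σ p v v≤σp = cnt-ext _ _ v (λ u u<v le → ≤∧≢⇒< le (λ e → <-irrefl (ω≡⇒σ (sym e)) (<-≤-trans u<v v≤σp)))
    (λ u _ → <⇒≤)

  ω-pos : ∀ u → 1 ≤ u → 1 ≤ ω u
  ω-pos u 1≤u with ω u in eq
  ... | zero = ⊥-elim (<-irrefl (sym (ωinj (trans eq (sym ω0)))) 1≤u)
  ... | suc _ = s≤s z≤n

  -- every position from 1 on lies in column 1
  rank-one : ∀ n → rank 1 (suc n) ≡ n
  rank-one zero = trans (+-identityʳ _) (ind-no (1 ≤? ω 0) (λ le → 1+n≰n (subst (1 ≤_) ω0 le)))
  rank-one (suc n) = trans (cong (_+ rank 1 (suc n)) (ind-yes (1 ≤? ω (suc n)) (ω-pos (suc n) (s≤s z≤n))))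
                           (cong suc (rank-one n))

  -- If every tower from column p on is empty and p ≤ ω a, then the positions
  -- u < a with p ≤ ω u are exactly σ p, …, σ (ω a − 1).
  module EmptyTail (p : ℕ) (empty : ∀ q → p ≤ q → code q ≡ 0) (a : ℕ) (p≤ωa : p ≤ ω a) where

    σ-before : ∀ q → p ≤ q → q < ω a → σ q < a
    σ-before q p≤q q<ωa with <-cmp (σ q) a
    ... | tri< lt _ _ = lt
    ... | tri≈ _ e _ = ⊥-elim (<-irrefl (trans (sym (ωσ q)) (cong ω e)) q<ωa)
    ... | tri> _ _ gt = ⊥-elim (<-irrefl (sym (empty q p≤q)) (cnt-pos (λ u → q <? ω u) (σ q) a gt q<ωa))

    window : ℕ → ℕ
    window d = cnt (λ u → (p ≤? ω u) ×-dec (ω u <? p + d)) a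

    window≡ : ∀ d → p + d ≤ ω a → window d ≡ d
    window≡ zero _ = cnt-zero _ a (λ u _ (p≤ωu , ωu<p) → <⇒≱ ωu<p (subst (_≤ ω u) (sym (+-identityʳ p)) p≤ωu))
    window≡ (suc d) le = begin
        window (suc d)
          ≡⟨ cnt-point _ c a c<a ⟩
        cnt (λ u → ((p ≤? ω u) ×-dec (ω u <? p + suc d)) ×-dec ¬? (u ≟ c)) a + ind ((p ≤? ω c) ×-dec (ω c <? p + suc d))
          ≡⟨ cong₂ _+_ (cnt-ext _ _ a drop-c add-c) (ind-yes ((p ≤? ω c) ×-dec (ω c <? p + suc d)) (p≤ωc , ωc<)) ⟩
        window d + 1
          ≡⟨ cong (_+ 1) (window≡ d (≤-trans (+-monoʳ-≤ p (n≤1+n d)) le)) ⟩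
        d + 1
          ≡⟨ +-comm d 1 ⟩
        suc d ∎
      where
      open ≡-Reasoning
      c = σ (p + d)
      c<a : c < a
      c<a = σ-before (p + d) (m≤m+n p d) (subst (_≤ ω a) (+-suc p d) le)
      p≤ωc : p ≤ ω c
      p≤ωc = subst (p ≤_) (sym (ωσ (p + d))) (m≤m+n p d)
      ωc< : ω c < p + suc d
      ωc< = subst₂ _<_ (sym (ωσ (p + d))) (sym (+-suc p d)) (n<1+n (p + d))
      drop-c : ∀ u → u < a → ((p ≤ ω u × ω u < p + suc d) × u ≢ c) → (p ≤ ω u × ω u < p + d)
      drop-c u _ ((p≤ωu , ωu<) , u≢c) =
        p≤ωu , ≤∧≢⇒< (s≤s⁻¹ (subst (ω u <_) (+-suc p d) ωu<)) (λ e → u≢c (ω≡⇒σ e))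
      add-c : ∀ u → u < a → (p ≤ ω u × ω u < p + d) → ((p ≤ ω u × ω u < p + suc d) × u ≢ c)
      add-c u _ (p≤ωu , ωu<) = (p≤ωu , ≤-trans ωu< (+-monoʳ-≤ p (n≤1+n d))) ,
                               λ e → <-irrefl (sym (trans (sym (ωσ (p + d))) (cong ω (sym e)))) ωu<

    -- every position u < a with p ≤ ω u has ω u < ω a
    rank≡window : rank p a ≡ window (ω a ∸ p)
    rank≡window = cnt-ext _ _ a (λ u u<a p≤ωu → p≤ωu , smaller u u<a p≤ωu) (λ u _ → proj₁)
      where
      smaller : ∀ u → u < a → p ≤ ω u → ω u < p + (ω a ∸ p)
      smaller u u<a _ with <-cmp (ω u) (ω a)
      ... | tri< x _ _ = subst (ω u <_) (sym (m+[n∸m]≡n p≤ωa)) x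
      ... | tri≈ _ e _ = ⊥-elim (<-irrefl (ωinj e) u<a)
      ... | tri> _ _ gt = ⊥-elim (<-irrefl (sym (empty (ω a) p≤ωa))
                              (cnt-pos (λ u → ω a <? ω u) (σ (ω a)) u (subst (u <_) (sym (σω a)) u<a) gt))

    rank-empty-tail : rank p a ≡ ω a ∸ p
    rank-empty-tail = trans rank≡window (window≡ (ω a ∸ p) (≤-reflexive (m+[n∸m]≡n p≤ωa)))

  -- Sliding the letter a with ω a < ω (a+1) into a diagram with heights `code`
  -- adds one cell, on tower ω a.
  module Slide (a : ℕ) (1≤a : 1 ≤ a) (ascent : ω a < ω (suc a)) where

    Heights : ℕ → List ℕ → Set
    Heights p L = ∀ q → p ≤ q → hAt p L q ≡ code q

    next-column : ∀ p → p ≤ ω a → a ≢ σ p → suc p ≤ ω a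
    next-column p p≤ωa ne = ≤∧≢⇒< p≤ωa (λ e → ne (ω≡⇒σ (sym e)))

    Heights-tail : ∀ p h L → Heights p (h ∷ L) → Heights (suc p) L
    Heights-tail p h L H q sp≤q = trans (sym (hAt-there p h L q (λ e → <-irrefl (sym e) sp≤q))) (H q (<⇒≤ sp≤q))

    Heights-head : ∀ p h L → Heights p (h ∷ L) → h ≡ rank p (σ p)
    Heights-head p h L H = trans (sym (hAt-here p h L)) (trans (H p ≤-refl) (code≡rank p))

    keep-head : ∀ p h L → h ≡ code p → p < ω a →
      (∀ q → suc p ≤ q → hAt (suc p) L q ≡ code q + ind (q ≟ ω a)) →
      ∀ q → p ≤ q → hAt p (h ∷ L) q ≡ code q + ind (q ≟ ω a)
    keep-head p h L h≡ p<ωa rest q p≤q with q ≟ p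
    ... | yes refl = trans h≡ (sym (trans (cong (code q +_) (ind-no (q ≟ ω a) (<⇒≢ p<ωa))) (+-identityʳ _)))
    ... | no ne = rest q (≤∧≢⇒< p≤q (λ e → ne (sym e)))

    -- if a < σ p then σ p ≠ a + 1 (ascent at a), so column p contains both a and
    -- a + 1 before σ p; this is why the lowering rule never fires
    rank-gap : ∀ p → p ≤ ω a → a < σ p → suc (rank p a) ≢ rank p (σ p)
    rank-gap p p≤ωa a<σp rank+1 with <-cmp (suc a) (σ p)
    ... | tri< sa<σp _ _ = 1+n≰n (begin
          suc (suc (rank p a))   ≤⟨ s≤s (rank-strict p (n<1+n a) p≤ωa) ⟩
          suc (rank p (suc a))   ≤⟨ rank-strict p sa<σp (≤-trans p≤ωa (<⇒≤ ascent)) ⟩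
          rank p (σ p)           ≡⟨ sym rank+1 ⟩
          suc (rank p a)         ∎)
      where open ≤-Reasoning
    ... | tri≈ _ sa≡σp _ = <⇒≱ ascent (subst (_≤ ω a) (sym (trans (cong ω sa≡σp) (ωσ p))) p≤ωa)
    ... | tri> _ _ σp<sa = <⇒≱ a<σp (s≤s⁻¹ σp<sa)

    -- the invariant of the sliding algorithm: while passing tower p the current
    -- letter is s = p + rank p a
    slideAt-code : ∀ L p s → Heights p L → p ≤ ω a → s ≡ p + rank p a →
         ∀ q → p ≤ q → hAt p (slideAt p s L) q ≡ code q + ind (q ≟ ω a)
    slideAt-code [] p s H p≤ωa s≡ q p≤q = begin
        hAt p (replicate (s ∸ p) 0 ++ [ 1 ]) q
          ≡⟨ hAt-single (s ∸ p) p q ⟩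
        ind (q ≟ p + (s ∸ p))
          ≡⟨ cong (λ z → ind (q ≟ z)) lands-at-ωa ⟩
        ind (q ≟ ω a)
          ≡⟨ cong (_+ ind (q ≟ ω a)) (H q p≤q) ⟩
        code q + ind (q ≟ ω a) ∎
      where
      open ≡-Reasoning
      lands-at-ωa : p + (s ∸ p) ≡ ω a
      lands-at-ωa = begin
        p + (s ∸ p)            ≡⟨ cong (λ z → p + (z ∸ p)) s≡ ⟩
        p + (p + rank p a ∸ p) ≡⟨ cong (p +_) (m+n∸m≡n p (rank p a)) ⟩
        p + rank p a           ≡⟨ cong (p +_) (EmptyTail.rank-empty-tail p (λ q p≤q → sym (H q p≤q)) a p≤ωa) ⟩
        p + (ω a ∸ p)          ≡⟨ m+[n∸m]≡n p≤ωa ⟩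
        ω a                    ∎
    slideAt-code (h ∷ L) p s H p≤ωa s≡ with <-cmp s (p + h)
    -- s > p + h: a lies beyond σ p, go on to the next tower
    ... | tri> _ _ gt =
      keep-head p h (slideAt (suc p) s L) (trans (sym (hAt-here p h L)) (H p ≤-refl)) p<ωa
        (slideAt-code L (suc p) s (Heights-tail p h L H) p<ωa s≡′)
      where
      σp<a : σ p < a
      σp<a = rank-<⇒< p (+-cancelˡ-< p _ _ (subst₂ _<_ (cong (p +_) (Heights-head p h L H)) s≡ gt))
      p<ωa : suc p ≤ ω a
      p<ωa = next-column p p≤ωa (λ e → <-irrefl (sym e) σp<a)
      s≡′ : s ≡ suc p + rank (suc p) a
      s≡′ = trans s≡ (trans (cong (p +_) (rank-past-σ p a σp<a)) (+-suc p _))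
    -- s = p + h: a = σ p, raise tower p
    ... | tri≈ _ eq _ = raised
      where
      ωa≡p : ω a ≡ p
      ωa≡p = trans (cong ω (rank-inj p p≤ωa (≤-reflexive (sym (ωσ p)))
                      (+-cancelˡ-≡ p _ _ (trans (sym s≡) (trans eq (cong (p +_) (Heights-head p h L H)))))))
                   (ωσ p)
      raised : ∀ q → p ≤ q → hAt p (suc h ∷ L) q ≡ code q + ind (q ≟ ω a)
      raised q p≤q with q ≟ p
      ... | yes refl = trans (cong suc (trans (sym (hAt-here q h L)) (H q ≤-refl)))
                             (trans (+-comm 1 (code q)) (cong (code q +_) (sym (ind-yes (q ≟ ω a) (sym ωa≡p)))))
      ... | no ne = trans (trans (sym (hAt-there p h L q ne)) (H q p≤q))
                          (sym (trans (cong (code q +_) (ind-no (q ≟ ω a) (λ e → ne (trans e ωa≡p)))) (+-identityʳ _)))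
    -- s < p + h with h = 0 contradicts s ≥ p
    slideAt-code (zero ∷ L) p s H p≤ωa s≡ | tri< lt _ _ =
      ⊥-elim (<⇒≱ lt (subst (_≤ s) (sym (+-identityʳ p)) (subst (p ≤_) (sym s≡) (m≤m+n p _))))
    -- s < p + h: a lies before σ p, so the lowering rule does not apply; go on with s + 1
    slideAt-code (suc h ∷ L) p s H p≤ωa s≡ | tri< lt _ _ = passed
      where
      a<σp : a < σ p
      a<σp = rank-<⇒< p (subst (_ <_) (Heights-head p (suc h) L H) (+-cancelˡ-< p _ _ (subst (_< p + suc h) s≡ lt)))
      p<ωa : suc p ≤ ω a
      p<ωa = next-column p p≤ωa (<⇒≢ a<σp)
      no-lowering : suc s ≢ p + suc h
      no-lowering e = rank-gap p p≤ωa a<σp (+-cancelˡ-≡ p _ _ (trans (+-suc p _) (trans (cong suc (sym s≡))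
                        (trans e (cong (p +_) (Heights-head p (suc h) L H))))))
      passed : ∀ q → p ≤ q →
        hAt p (if suc s ≡ᵇ p + suc h then h ∷ L else suc h ∷ slideAt (suc p) (suc s) L) q ≡ code q + ind (q ≟ ω a)
      passed q p≤q with ≡ᵇ-view (suc s) (p + suc h)
      ... | inj₁ (e , _) = ⊥-elim (no-lowering e)
      ... | inj₂ (_ , eb) rewrite eb =
        keep-head p (suc h) (slideAt (suc p) (suc s) L) (trans (sym (hAt-here p (suc h) L)) (H p ≤-refl)) p<ωa
          (slideAt-code L (suc p) (suc s) (Heights-tail p (suc h) L H) p<ωa
             (trans (cong suc s≡) (cong (suc p +_) (rank-upto-σ p a (<⇒≤ a<σp))))) q p≤q

    s : ℕ → ℕ
    s = sgen a

    fixes-below : ∀ u → u < a → s u ≡ u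
    fixes-below u u<a = transp-o a (suc a) u (<⇒≢ u<a) (<⇒≢ (<-trans u<a (n<1+n a)))

    cnt-s-below : ∀ p → cnt (λ u → p <? ω (s u)) a ≡ cnt (λ u → p <? ω u) a
    cnt-s-below p = cnt-ext _ _ a (λ u u<a → subst (p <_) (cong ω (fixes-below u u<a)))
                                  (λ u u<a → subst (p <_) (cong ω (sym (fixes-below u u<a))))

    -- the code of ω ∘ s, whose inverse is s ∘ σ
    code′ : ℕ → ℕ
    code′ p = cnt (λ u → p <? ω (s u)) (s (σ p))

    no-new-cell : ∀ p → p ≢ ω a → code p ≡ code p + ind (p ≟ ω a)
    no-new-cell p ne = sym (trans (cong (code p +_) (ind-no (p ≟ ω a) ne)) (+-identityʳ _))

    code′-before : ∀ p → σ p < a → code′ p ≡ code p + ind (p ≟ ω a)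
    code′-before p σp<a = begin
        cnt (λ u → p <? ω (s u)) (s (σ p))
          ≡⟨ cong (cnt (λ u → p <? ω (s u))) (fixes-below (σ p) σp<a) ⟩
        cnt (λ u → p <? ω (s u)) (σ p)
          ≡⟨ cnt-ext _ _ (σ p) (λ u u<σp → subst (p <_) (cong ω (fixes-below u (<-trans u<σp σp<a))))
                                (λ u u<σp → subst (p <_) (cong ω (sym (fixes-below u (<-trans u<σp σp<a))))) ⟩
        code p
          ≡⟨ no-new-cell p (λ e → <-irrefl (sym (ω≡⇒σ (sym e))) σp<a) ⟩
        code p + ind (p ≟ ω a) ∎
      where open ≡-Reasoning

    code′-at-a : ∀ p → σ p ≡ a → code′ p ≡ code p + ind (p ≟ ω a)
    code′-at-a p σp≡a = begin
        cnt (λ u → p <? ω (s u)) (s (σ p))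
          ≡⟨ cong (cnt (λ u → p <? ω (s u))) (trans (cong s σp≡a) (transp-a a (suc a))) ⟩
        ind (p <? ω (s a)) + cnt (λ u → p <? ω (s u)) a
          ≡⟨ cong₂ _+_ (ind-yes (p <? ω (s a)) (subst₂ _<_ (sym p≡ωa) (cong ω (sym (transp-a a (suc a)))) ascent))
                       (cnt-s-below p) ⟩
        1 + cnt (λ u → p <? ω u) a
          ≡⟨ +-comm 1 _ ⟩
        cnt (λ u → p <? ω u) a + 1
          ≡⟨ cong₂ _+_ (cong (cnt (λ u → p <? ω u)) (sym σp≡a)) (sym (ind-yes (p ≟ ω a) p≡ωa)) ⟩
        code p + ind (p ≟ ω a) ∎
      where
      open ≡-Reasoning
      p≡ωa : p ≡ ω a
      p≡ωa = trans (sym (ωσ p)) (cong ω σp≡a)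

    code′-at-suc-a : ∀ p → σ p ≡ suc a → code′ p ≡ code p + ind (p ≟ ω a)
    code′-at-suc-a p σp≡sa = begin
        cnt (λ u → p <? ω (s u)) (s (σ p))
          ≡⟨ cong (cnt (λ u → p <? ω (s u))) (trans (cong s σp≡sa) (transp-b a (suc a))) ⟩
        cnt (λ u → p <? ω (s u)) a
          ≡⟨ cnt-s-below p ⟩
        cnt (λ u → p <? ω u) a
          ≡⟨ sym (cong (_+ cnt (λ u → p <? ω u) a) (ind-no (p <? ω a) (λ x → <-asym x (subst (ω a <_) (sym p≡ωsa) ascent)))) ⟩
        cnt (λ u → p <? ω u) (suc a)
          ≡⟨ cong (cnt (λ u → p <? ω u)) (sym σp≡sa) ⟩
        code p
          ≡⟨ no-new-cell p (λ e → <-irrefl (trans (sym e) p≡ωsa) ascent) ⟩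
        code p + ind (p ≟ ω a) ∎
      where
      open ≡-Reasoning
      p≡ωsa : p ≡ ω (suc a)
      p≡ωsa = trans (sym (ωσ p)) (cong ω σp≡sa)

    code′-after : ∀ p → a < σ p → suc a < σ p → code′ p ≡ code p + ind (p ≟ ω a)
    code′-after p a<σp sa<σp = begin
        cnt (λ u → p <? ω (s u)) (s (σ p))
          ≡⟨ cong (cnt (λ u → p <? ω (s u))) (transp-o a (suc a) (σ p) (λ e → <-irrefl (sym e) a<σp) (λ e → <-irrefl (sym e) sa<σp)) ⟩
        cnt (λ u → p <? ω (s u)) (σ p)
          ≡⟨ cnt-swap (λ v → p <? ω v) s a (suc a) (σ p) (n<1+n a) sa<σp (transp-a a (suc a)) (transp-b a (suc a)) (transp-o a (suc a)) ⟩
        code p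
          ≡⟨ no-new-cell p (λ e → <-irrefl (ω≡⇒σ (sym e)) a<σp) ⟩
        code p + ind (p ≟ ω a) ∎
      where open ≡-Reasoning

    code-after-ascent : ∀ p → code′ p ≡ code p + ind (p ≟ ω a)
    code-after-ascent p with <-cmp (σ p) a
    ... | tri< σp<a _ _ = code′-before p σp<a
    ... | tri≈ _ σp≡a _ = code′-at-a p σp≡a
    ... | tri> _ _ a<σp with <-cmp (σ p) (suc a)
    ...   | tri< σp<sa _ _ = ⊥-elim (<⇒≱ a<σp (s≤s⁻¹ σp<sa))
    ...   | tri≈ _ σp≡sa _ = code′-at-suc-a p σp≡sa
    ...   | tri> _ _ sa<σp = code′-after p a<σp sa<σp

    slide-code : ∀ T → (∀ p → 1 ≤ p → height T p ≡ code p) → ∀ p → 1 ≤ p → height (slide a T) p ≡ code′ p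
    slide-code T H p 1≤p = begin
        height (slide a T) p
          ≡⟨ height≡hAt (slide a T) p 1≤p ⟩
        hAt 1 (slideAt 1 a T) p
          ≡⟨ slideAt-code T 1 a (λ q 1≤q → trans (sym (height≡hAt T q 1≤q)) (H q 1≤q)) (ω-pos a 1≤a) a≡1+rank p 1≤p ⟩
        code p + ind (p ≟ ω a)
          ≡⟨ sym (code-after-ascent p) ⟩
        code′ p ∎
      where
      open ≡-Reasoning
      a≡1+rank : a ≡ 1 + rank 1 a
      a≡1+rank = trans (sym (suc-pred a {{>-nonZero 1≤a}}))
                       (cong suc (sym (trans (cong (rank 1) (sym (suc-pred a {{>-nonZero 1≤a}}))) (rank-one (pred a)))))

record Coded (T : List ℕ) (ω : ℕ → ℕ) : Set where
  field
    σ : ℕ → ℕ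
    σω : ∀ x → σ (ω x) ≡ x
    ωσ : ∀ x → ω (σ x) ≡ x
    ω0 : ω 0 ≡ 0
    heights : ∀ p → 1 ≤ p → height T p ≡ Ranks.code ω σ σω ωσ ω0 p

Coded-injective : ∀ {T ω} → Coded T ω → Injective _≡_ _≡_ ω
Coded-injective c = Ranks.ωinj _ (Coded.σ c) (Coded.σω c) (Coded.ωσ c) (Coded.ω0 c)

Coded-empty : Coded [] (λ x → x)
Coded-empty = record { σ = λ x → x ; σω = λ x → refl ; ωσ = λ x → refl ; ω0 = refl
                     ; heights = λ p _ → sym (cnt-zero _ p (λ u u<p p<u → <-asym u<p p<u)) }

Coded-slide : ∀ T ω a → Coded T ω → 1 ≤ a → ω a < ω (suc a) → Coded (slide a T) (λ x → ω (sgen a x))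
Coded-slide T ω a c 1≤a ascent = record
  { σ = λ x → sgen a (σ x)
  ; σω = λ x → trans (cong (sgen a) (σω (sgen a x))) (transp-inv a (suc a) x)
  ; ωσ = λ x → trans (cong ω (transp-inv a (suc a) (σ x))) (ωσ x)
  ; ω0 = trans (cong ω (transp-o a (suc a) 0 (<⇒≢ 1≤a) (<⇒≢ (s≤s z≤n)))) ω0
  ; heights = Ranks.Slide.slide-code ω σ σω ωσ ω0 a 1≤a ascent T heights
  }
  where open Coded c

Letters : ℕ → List ℕ → Set
Letters N v = All (λ a → 1 ≤ a × suc a ≤ N) v

letters : ∀ w M → All (1 ≤_) w → maxL w ≤ M → Letters (suc M) w
letters [] M _ _ = []
letters (a ∷ w) M (1≤a ∷ ps) le =
  (1≤a , s≤s (≤-trans (m≤m⊔n a (maxL w)) le)) ∷ letters w M ps (≤-trans (m≤n⊔m a (maxL w)) le)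

-- each letter changes the length by one, so a word of length m adds at most m
inv-word-bound : ∀ N v ω → Injective _≡_ _≡_ ω → Letters N v →
  inv (λ x → ω (evalWord v x)) N ≤ inv ω N + length v
inv-word-bound N [] ω inj _ = ≤-reflexive (sym (+-identityʳ _))
inv-word-bound N (a ∷ v) ω inj ((1≤a , saN) ∷ ls) with adjacent ω inj a N 1≤a saN
... | inj₁ (_ , e) = ≤-trans (inv-word-bound N v (λ x → ω (sgen a x)) (transp-injective a (suc a) ω inj) ls)
                        (≤-reflexive (trans (cong (_+ length v) e) (sym (+-suc _ _))))
... | inj₂ (_ , e) = ≤-trans (inv-word-bound N v (λ x → ω (sgen a x)) (transp-injective a (suc a) ω inj) ls)
                        (≤-trans (n≤1+n _) (≤-trans (≤-reflexive (cong (_+ length v) (sym e)))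
                                                    (+-monoʳ-≤ (inv ω N) (n≤1+n _))))

-- along a word that adds its full length, every letter is an ascent, so the
-- sliding algorithm keeps computing the code
Coded-foldl : ∀ N v T ω → Coded T ω → Letters N v →
  inv (λ x → ω (evalWord v x)) N ≡ inv ω N + length v →
  Coded (foldl (λ T a → slide a T) T v) (λ x → ω (evalWord v x))
Coded-foldl N [] T ω c _ _ = c
Coded-foldl N (a ∷ v) T ω c ((1≤a , saN) ∷ ls) h with adjacent ω (Coded-injective c) a N 1≤a saN
... | inj₁ (ascent , e) = Coded-foldl N v (slide a T) (λ x → ω (sgen a x)) (Coded-slide T ω a c 1≤a ascent) ls
        (trans h (trans (+-suc _ _) (cong (_+ length v) (sym e))))
... | inj₂ (_ , e) = ⊥-elim (1+n≰n (≤-trans too-long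
                       (inv-word-bound N v (λ x → ω (sgen a x)) (transp-injective a (suc a) ω (Coded-injective c)) ls)))
  where
  too-long : suc (inv (λ x → ω (sgen a x)) N + length v) ≤ inv (λ x → ω (sgen a (evalWord v x))) N
  too-long = subst (suc (inv (λ x → ω (sgen a x)) N + length v) ≤_) (sym h)
               (≤-trans (≤-reflexive (cong (_+ length v) (sym e))) (+-monoʳ-≤ (inv ω N) (n≤1+n _)))

inv-id : ∀ N → inv (λ x → x) N ≡ 0
inv-id N = trans (inv≡Inv (λ x → x) N) (Inv-suc N)
  where
  Inv-suc : ∀ N → Inv suc N ≡ 0
  Inv-suc zero = refl
  Inv-suc (suc N) = cong₂ _+_ (cnt-zero _ N (λ u u<N x → <-asym u<N (s≤s⁻¹ x))) (Inv-suc N)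

towerOf-Coded : ∀ w → Reduced w → Coded (towerOf w) (evalWord w)
towerOf-Coded w (ps , len) = Coded-foldl (suc (maxL w)) w [] (λ x → x) Coded-empty (letters w (maxL w) ps ≤-refl)
  (trans (sym len) (cong (_+ length w) (sym (inv-id (suc (maxL w))))))

-- Flight numbers and the Schubert path

fn-in : ∀ Tw a b → 1 ≤ a → b < height Tw a → fn Tw (suc a) b ≡ fn Tw a b
fn-in Tw (suc a) b _ lt rewrite Equivalence.to T-≡ (<⇒<ᵇ lt) = refl

fn-out : ∀ Tw a b → 1 ≤ a → height Tw a ≤ b → fn Tw (suc a) b ≡ fn Tw a (suc b)
fn-out Tw (suc a) b _ ge with b <ᵇ height Tw (suc a) in eq
... | true = ⊥-elim (<⇒≱ (<ᵇ⇒< b _ (subst T (sym eq) tt)) ge)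
... | false = refl

module Diagram (Tw : List ℕ) (ω : ℕ → ℕ) (coded : Coded Tw ω) where
  open Coded coded
  open Ranks ω σ σω ωσ ω0 public

  p≤ωσp : ∀ p → p ≤ ω (σ p)
  p≤ωσp p = ≤-reflexive (sym (ωσ p))

  height≡rank : ∀ p → 1 ≤ p → height Tw p ≡ rank p (σ p)
  height≡rank p 1≤p = trans (heights p 1≤p) (code≡rank p)

  -- fn T a b is the position of the (b+1)-st u with a ≤ ω u
  -- (stated for column a + 1, by induction on a)
  fn-spec′ : ∀ a b → suc a ≤ ω (fn Tw (suc a) b) × rank (suc a) (fn Tw (suc a) b) ≡ b
  fn-spec′ zero b = ω-pos (suc b) (s≤s z≤n) , rank-one b
  fn-spec′ (suc a) b with b <? height Tw (suc a)
  ... | yes lt = subst (λ z → suc (suc a) ≤ ω z × rank (suc (suc a)) z ≡ b) (sym (fn-in Tw (suc a) b (s≤s z≤n) lt))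
                  (≤∧≢⇒< fv (λ e → <-irrefl (ω≡⇒σ (sym e)) v<σ) , trans (sym (rank-upto-σ (suc a) v (<⇒≤ v<σ))) rv)
    where
    v = fn Tw (suc a) b
    fv = proj₁ (fn-spec′ a b)
    rv = proj₂ (fn-spec′ a b)
    v<σ : v < σ (suc a)
    v<σ = rank-<⇒< (suc a) (subst₂ _<_ (sym rv) (height≡rank (suc a) (s≤s z≤n)) lt)
  ... | no nlt = subst (λ z → suc (suc a) ≤ ω z × rank (suc (suc a)) z ≡ b) (sym (fn-out Tw (suc a) b (s≤s z≤n) (≮⇒≥ nlt)))
                  (≤∧≢⇒< fv (λ e → <-irrefl (sym (ω≡⇒σ (sym e))) σ<v) , suc-injective (trans (sym (rank-past-σ (suc a) v σ<v)) rv))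
    where
    v = fn Tw (suc a) (suc b)
    fv = proj₁ (fn-spec′ a (suc b))
    rv = proj₂ (fn-spec′ a (suc b))
    σ<v : σ (suc a) < v
    σ<v = rank-<⇒< (suc a) (subst₂ _<_ (height≡rank (suc a) (s≤s z≤n)) (sym rv) (s≤s (≮⇒≥ nlt)))

  fn-spec : ∀ a b → 1 ≤ a → a ≤ ω (fn Tw a b) × rank a (fn Tw a b) ≡ b
  fn-spec (suc a) b _ = fn-spec′ a b

  fn-column : ∀ a b → 1 ≤ a → a ≤ ω (fn Tw a b)
  fn-column a b 1≤a = proj₁ (fn-spec a b 1≤a)

  fn-rank : ∀ a b → 1 ≤ a → rank a (fn Tw a b) ≡ b
  fn-rank a b 1≤a = proj₂ (fn-spec a b 1≤a)

  fn-mono : ∀ a b → 1 ≤ a → fn Tw a b < fn Tw a (suc b)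
  fn-mono a b 1≤a = rank-<⇒< a (subst₂ _<_ (sym (fn-rank a b 1≤a)) (sym (fn-rank a (suc b) 1≤a)) (n<1+n b))

  index≡σ : ∀ s → 1 ≤ s → index Tw s ≡ σ s
  index≡σ s 1≤s = rank-inj s (fn-column s _ 1≤s) (p≤ωσp s) (trans (fn-rank s _ 1≤s) (height≡rank s 1≤s))

  module SchubertPath (k : ℕ) (1≤k : 1 ≤ k) where

    path⇒fn : ∀ {a b} → InPath Tw k a b → 1 ≤ a × fn Tw a b ≤ k × k < fn Tw a (suc b)
    path⇒fn start = s≤s z≤n , ≤-reflexive k≡ , subst (_< suc (suc (pred k))) k≡ (n<1+n _)
      where k≡ = suc-pred k {{>-nonZero 1≤k}}
    path⇒fn {suc a} {b} (stepIn p inT) with path⇒fn p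
    ... | 1≤a , le , lt = s≤s z≤n , subst (_≤ k) (sym (fn-in Tw a b 1≤a inT)) le , above
      where
      above : k < fn Tw (suc a) (suc b)
      above with suc b <? height Tw a
      ... | yes x = subst (k <_) (sym (fn-in Tw a (suc b) 1≤a x)) lt
      ... | no x = subst (k <_) (sym (fn-out Tw a (suc b) 1≤a (≮⇒≥ x))) (<-trans lt (fn-mono a (suc b) 1≤a))
    path⇒fn {suc a} {b} (stepOut p nin) with path⇒fn p
    ... | 1≤a , le , lt = s≤s z≤n , below , subst (k <_) (sym (fn-out Tw a (suc b) 1≤a (≮⇒≥ nin))) lt
      where
      below : fn Tw (suc a) b ≤ k
      below with b <? height Tw a
      ... | yes x = subst (_≤ k) (sym (fn-in Tw a b 1≤a x)) (≤-trans (<⇒≤ (fn-mono a b 1≤a)) le)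
      ... | no x = subst (_≤ k) (sym (fn-out Tw a b 1≤a (≮⇒≥ x))) le

    fn⇒path′ : ∀ a b → fn Tw (suc a) b ≤ k → k < fn Tw (suc a) (suc b) → InPath Tw k (suc a) b
    fn⇒path′ zero b le lt = subst (InPath Tw k 1) (cong pred (≤-antisym (s≤s⁻¹ lt) le)) start
    fn⇒path′ (suc a) b le lt with b <? height Tw (suc a)
    ... | yes x with suc b <? height Tw (suc a)
    ...   | yes y = stepIn (fn⇒path′ a b (subst (_≤ k) (fn-in Tw (suc a) b (s≤s z≤n) x) le)
                                  (subst (k <_) (fn-in Tw (suc a) (suc b) (s≤s z≤n) y) lt)) x
    ...   | no y with k <? fn Tw (suc a) (suc b)
    ...     | yes z = stepIn (fn⇒path′ a b (subst (_≤ k) (fn-in Tw (suc a) b (s≤s z≤n) x) le) z) x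
    ...     | no z = stepOut (fn⇒path′ a (suc b) (≮⇒≥ z)
                          (subst (k <_) (fn-out Tw (suc a) (suc b) (s≤s z≤n) (≮⇒≥ y)) lt)) y
    fn⇒path′ (suc a) b le lt | no x =
      stepOut (fn⇒path′ a (suc b) (subst (_≤ k) (fn-out Tw (suc a) b (s≤s z≤n) (≮⇒≥ x)) le)
                  (subst (k <_) (fn-out Tw (suc a) (suc b) (s≤s z≤n) (≤-trans (≮⇒≥ x) (n≤1+n b))) lt))
              (λ y → x (<-trans (n<1+n b) y))

    fn⇒path : ∀ a b → 1 ≤ a → fn Tw a b ≤ k → k < fn Tw a (suc b) → InPath Tw k a b
    fn⇒path (suc a) b _ = fn⇒path′ a b

    path⇒rank : ∀ {a b} → InPath Tw k a b → rank a (suc k) ≡ suc b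
    path⇒rank {a} {b} p with path⇒fn p
    ... | 1≤a , le , lt = ≤-antisym
         (subst (rank a (suc k) ≤_) (fn-rank a (suc b) 1≤a) (rank-mono a lt))
         (subst (λ z → suc z ≤ rank a (suc k)) (fn-rank a b 1≤a) (rank-strict a (s≤s le) (fn-column a b 1≤a)))

    rank⇒path : ∀ a b → 1 ≤ a → rank a (suc k) ≡ suc b → InPath Tw k a b
    rank⇒path a b 1≤a e = fn⇒path a b 1≤a le lt
      where
      le : fn Tw a b ≤ k
      le with fn Tw a b ≤? k
      ... | yes x = x
      ... | no x = ⊥-elim (<⇒≱ (n<1+n b) (subst₂ _≤_ e (fn-rank a b 1≤a) (rank-mono a (≰⇒> x))))
      lt : k < fn Tw a (suc b)
      lt with k <? fn Tw a (suc b)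
      ... | yes x = x
      ... | no x = ⊥-elim (<⇒≱ (n<1+n (suc b))
                     (subst₂ (λ y z → suc y ≤ z) (fn-rank a (suc b) 1≤a) e (rank-strict a (s≤s (≮⇒≥ x)) (fn-column a (suc b) 1≤a))))

least : ∀ {P : Pred} (P? : DecP P) n → P n → ∃[ m ] (m ≤ n × P m × (∀ m' → m' < m → ¬ P m'))
least {P} P? n pn with search (suc n)
  where
  search : ∀ n → (∃[ m ] (m < n × P m × (∀ m' → m' < m → ¬ P m'))) ⊎ (∀ m → m < n → ¬ P m)
  search zero = inj₂ (λ m ())
  search (suc n) with search n
  ... | inj₁ (m , m<n , pm , minimal) = inj₁ (m , m≤n⇒m≤1+n m<n , pm , minimal)
  ... | inj₂ none with P? n
  ...   | yes pn = inj₁ (n , n<1+n n , pn , none)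
  ...   | no ¬pn = inj₂ (λ m m<sn → [ none m , (λ e → subst (λ z → ¬ P z) (sym e) ¬pn) ]′ (m≤n⇒m<n∨m≡n (s≤s⁻¹ m<sn)))
... | inj₁ (m , m<sn , pm , minimal) = m , s≤s⁻¹ m<sn , pm , minimal
... | inj₂ none = ⊥-elim (none n (n<1+n n) pn)

-- The setting of the theorem: ω' = ω t_{i,j} covers ω and s is the tower with index i.
module Cover (w : List ℕ) (red : Reduced w) (i j : ℕ) (1≤i : 1 ≤ i) (i<j : i < j)
    (longer : inv (λ x → evalWord w (transp i j x)) (suc (maxL w) ⊔ j) ≡ suc (inv (evalWord w) (suc (maxL w) ⊔ j)))
    (w' : List ℕ) (red' : Reduced w') (ω'≡ : ∀ x → evalWord w' x ≡ evalWord w (transp i j x))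
    (s r : ℕ) (1≤s : 1 ≤ s) (index≡i : index (towerOf w) s ≡ i)
    (grown : height (towerOf w') s ≡ height (towerOf w) s + suc r) where

  Tw = towerOf w
  ω = evalWord w
  open Diagram Tw ω (towerOf-Coded w red)
  open Coded (towerOf-Coded w red) using (σ; σω; ωσ)
  module D' = Diagram (towerOf w') (evalWord w') (towerOf-Coded w' red')

  c = height Tw s

  ωi<ωj : ω i < ω j
  ωi<ωj = proj₁ (cover ω ωinj i j (suc (maxL w) ⊔ j) 1≤i i<j (m≤n⊔m _ j) longer)

  nothing-between : ∀ x → i < x → x < j → ω i < ω x → ω x < ω j → ⊥
  nothing-between = proj₂ (cover ω ωinj i j (suc (maxL w) ⊔ j) 1≤i i<j (m≤n⊔m _ j) longer)

  σs≡i : σ s ≡ i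
  σs≡i = trans (sym (index≡σ s 1≤s)) index≡i

  ωi≡s : ω i ≡ s
  ωi≡s = trans (cong ω (sym σs≡i)) (ωσ s)

  s<ωj : s < ω j
  s<ωj = subst (_< ω j) ωi≡s ωi<ωj

  ω≢s : ∀ u → u ≢ i → ω u ≢ s
  ω≢s u ne e = ne (trans (ω≡⇒σ e) σs≡i)

  c≡rank-i : c ≡ rank s i
  c≡rank-i = trans (height≡rank s 1≤s) (cong (rank s) σs≡i)

  rank-s-suc-i : rank s (suc i) ≡ suc c
  rank-s-suc-i = trans (cong (_+ rank s i) (ind-yes (s ≤? ω i) (≤-reflexive (sym ωi≡s)))) (cong suc (sym c≡rank-i))

  σ's≡j : Coded.σ (towerOf-Coded w' red') s ≡ j
  σ's≡j = trans (sym (transp-inv i j σ's)) (trans (cong (transp i j) t-σ's≡i) (transp-a i j))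
    where
    σ's = Coded.σ (towerOf-Coded w' red') s
    t-σ's≡i : transp i j σ's ≡ i
    t-σ's≡i = ωinj (trans (sym (ω'≡ σ's)) (trans (Coded.ωσ (towerOf-Coded w' red') s) (sym ωi≡s)))

  rank-s-j : rank s j ≡ c + suc r
  rank-s-j = trans (sym code′≡) (trans (sym (Coded.heights (towerOf-Coded w' red') s 1≤s)) grown)
    where
    open ≡-Reasoning
    ω'≡ω : ∀ u → u < j → u ≢ i → evalWord w' u ≡ ω u
    ω'≡ω u u<j u≢i = trans (ω'≡ u) (cong ω (transp-o i j u u≢i (<⇒≢ u<j)))
    code′≡ : D'.code s ≡ rank s j
    code′≡ = begin
        cnt (λ u → s <? evalWord w' u) (Coded.σ (towerOf-Coded w' red') s)
          ≡⟨ cong (cnt (λ u → s <? evalWord w' u)) σ's≡j ⟩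
        cnt (λ u → s <? evalWord w' u) j
          ≡⟨ cnt-point _ i j i<j ⟩
        cnt (λ u → (s <? evalWord w' u) ×-dec ¬? (u ≟ i)) j + ind (s <? evalWord w' i)
          ≡⟨ cong₂ _+_
               (cnt-ext _ _ j
                 (λ u u<j (lt , u≢i) → <⇒≤ (subst (s <_) (ω'≡ω u u<j u≢i) lt) , u≢i)
                 (λ u u<j (le , u≢i) → subst (s <_) (sym (ω'≡ω u u<j u≢i)) (≤∧≢⇒< le (λ e → ω≢s u u≢i (sym e))) , u≢i))
               (trans (ind-yes (s <? evalWord w' i) (subst (s <_) (sym (trans (ω'≡ i) (cong ω (transp-a i j)))) s<ωj))
                      (sym (ind-yes (s ≤? ω i) (≤-reflexive (sym ωi≡s))))) ⟩
        cnt (λ u → (s ≤? ω u) ×-dec ¬? (u ≟ i)) j + ind (s ≤? ω i)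
          ≡⟨ sym (cnt-point _ i j i<j) ⟩
        rank s j ∎

  module _ (k : ℕ) (1≤k : 1 ≤ k) where
    open SchubertPath k 1≤k

    -- (1) ⇔ (2): column s of the path of k sits at height rank s (k+1) − 1
    on-path⇔ : (i ≤ k × k < j) ⇔ (∃[ q ] (q ≤ r × InPath Tw k s (c + q)))
    on-path⇔ = mk⇔ to from
      where
      to : (i ≤ k × k < j) → ∃[ q ] (q ≤ r × InPath Tw k s (c + q))
      to (i≤k , k<j) = q , q≤r , rank⇒path s (c + q) 1≤s m≡
        where
        m = rank s (suc k)
        lower : suc c ≤ m
        lower = subst (_≤ m) rank-s-suc-i (rank-mono s (s≤s i≤k))
        upper : m ≤ c + suc r
        upper = subst (m ≤_) rank-s-j (rank-mono s k<j)
        q = m ∸ suc c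
        m≡ : m ≡ suc (c + q)
        m≡ = sym (m+[n∸m]≡n lower)
        q≤r : q ≤ r
        q≤r = +-cancelˡ-≤ c q r (s≤s⁻¹ (subst₂ _≤_ m≡ (+-suc c r) upper))
      from : ∃[ q ] (q ≤ r × InPath Tw k s (c + q)) → (i ≤ k × k < j)
      from (q , q≤r , p) = i≤k , k<j
        where
        e = path⇒rank p
        i≤k : i ≤ k
        i≤k with i ≤? k
        ... | yes x = x
        ... | no x = ⊥-elim (<⇒≱ (s≤s (m≤m+n c q)) (subst₂ _≤_ e (sym c≡rank-i) (rank-mono s (≰⇒> x))))
        k<j : k < j
        k<j with k <? j
        ... | yes x = x
        ... | no x = ⊥-elim (<⇒≱ (s≤s (subst (c + q <_) (sym (+-suc c r)) (s≤s (+-monoʳ-≤ c q≤r))))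
                        (subst₂ _≤_ (cong suc rank-s-j) e
                                (≤-trans (rank-strict s (n<1+n j) (<⇒≤ s<ωj)) (rank-mono s (s≤s (≮⇒≥ x))))))

    -- below the path cell of column s lie the c cells of T and one cell for
    -- each u with i < u ≤ k and s < ω u
    later-count : ∀ q → i ≤ k → InPath Tw k s (c + q) → cnt (λ u → (i <? u) ×-dec (s <? ω u)) (suc k) ≡ q
    later-count q i≤k p = suc-injective (+-cancelˡ-≡ c _ _ (trans (sym split) (trans (path⇒rank p) (sym (+-suc c q)))))
      where
      open ≡-Reasoning
      Later = cnt (λ u → (i <? u) ×-dec (s <? ω u)) (suc k)
      split : rank s (suc k) ≡ c + suc Later
      split = begin
          rank s (suc k)
            ≡⟨ cnt-prefix _ i (suc k) (m≤n⇒m≤1+n i≤k) ⟩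
          rank s i + cnt (λ u → (i ≤? u) ×-dec (s ≤? ω u)) (suc k)
            ≡⟨ cong₂ _+_ (sym c≡rank-i) (cnt-point _ i (suc k) (s≤s i≤k)) ⟩
          c + (cnt (λ u → ((i ≤? u) ×-dec (s ≤? ω u)) ×-dec ¬? (u ≟ i)) (suc k) + ind ((i ≤? i) ×-dec (s ≤? ω i)))
            ≡⟨ cong (c +_) (cong₂ _+_
                  (cnt-ext _ _ (suc k)
                     (λ u _ ((i≤u , s≤ωu) , u≢i) → ≤∧≢⇒< i≤u (λ e → u≢i (sym e)) , ≤∧≢⇒< s≤ωu (λ e → ω≢s u u≢i (sym e)))
                     (λ u _ (i<u , s<ωu) → (<⇒≤ i<u , <⇒≤ s<ωu) , λ e → <-irrefl (sym e) i<u))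
                  (ind-yes ((i ≤? i) ×-dec (s ≤? ω i)) (≤-refl , ≤-reflexive (sym ωi≡s)))) ⟩
          c + (Later + 1)
            ≡⟨ cong (c +_) (+-comm Later 1) ⟩
          c + suc Later ∎

    -- For i ≤ k < j, the first column a' > s whose path cell lies in T is the
    -- least a' > s with k < σ a'; it exists since a' = ω j qualifies.
    module FirstColumnInT (i≤k : i ≤ k) (k<j : k < j) where

      first : ∃[ m ] (m ≤ ω j × (s < m × k < σ m) × (∀ m' → m' < m → ¬ (s < m' × k < σ m')))
      first = least (λ m → (s <? m) ×-dec (k <? σ m)) (ω j) (s<ωj , subst (k <_) (sym (σω j)) k<j)

      a' : ℕ
      a' = proj₁ first

      s<a' : s < a'
      s<a' = proj₁ (proj₁ (proj₂ (proj₂ first)))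

      1≤a' : 1 ≤ a'
      1≤a' = ≤-trans 1≤s (<⇒≤ s<a')

      before-a' : ∀ m → s < m → m < a' → σ m ≤ k
      before-a' m s<m m<a' with k <? σ m
      ... | yes x = ⊥-elim (proj₂ (proj₂ (proj₂ first)) m m<a' (s<m , x))
      ... | no x = ≮⇒≥ x

      -- positions i < u ≤ k with s < ω u carry values above ω j, as t_{i,j} is a cover
      later-above-a' : ∀ u → u < suc k → i < u × s < ω u → a' ≤ ω u
      later-above-a' u u≤k (i<u , s<ωu) = ≤-trans (proj₁ (proj₂ first)) (<⇒≤ ωj<ωu)
        where
        u<j : u < j
        u<j = ≤-<-trans (s≤s⁻¹ u≤k) k<j
        ωj<ωu : ω j < ω u
        ωj<ωu with <-cmp (ω u) (ω j)
        ... | tri< x _ _ = ⊥-elim (nothing-between u i<u u<j (subst (_< ω u) (sym ωi≡s) s<ωu) x)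
        ... | tri≈ _ x _ = ⊥-elim (<-irrefl (ωinj x) u<j)
        ... | tri> _ _ x = x

      at-least : ∀ q → InPath Tw k s (c + q) → q ≤ rank a' (suc k)
      at-least q p = subst (_≤ rank a' (suc k)) (later-count q i≤k p) (cnt-mono _ _ (suc k) later-above-a')

      cell-in-T : ∀ b → rank a' (suc k) ≡ suc b → InT Tw a' b
      cell-in-T b e = subst (b <_) (sym (height≡rank a' 1≤a'))
                        (subst (_≤ rank a' (σ a')) e (rank-mono a' (proj₂ (proj₁ (proj₂ (proj₂ first))))))

      -- a column m before a' has σ m ≤ k, so its path cell lies above its tower
      cells-before-not-in-T : ∀ m b → s < m → m < a' → InPath Tw k m b → ¬ InT Tw m b
      cells-before-not-in-T m b s<m m<a' p inT = <-irrefl refl (begin-strict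
          suc b                   ≤⟨ subst (b <_) (height≡rank m 1≤m) inT ⟩
          rank m (σ m)            <⟨ rank-strict m (s≤s (before-a' m s<m m<a')) (p≤ωσp m) ⟩
          rank m (suc k)          ≡⟨ path⇒rank p ⟩
          suc b                   ∎)
        where
        open ≤-Reasoning
        1≤m = ≤-trans 1≤s (<⇒≤ s<m)

    new-cell-not-in-T : ∀ q → ¬ InT Tw s (c + q)
    new-cell-not-in-T q inT = <⇒≱ inT (m≤m+n c q)

    critical : ∀ q → q ≤ r → InPath Tw k s (c + q) → Critical Tw k s (c + q)
    -- the lowest new cell has no empty cells below it
    critical zero _ p = p , new-cell-not-in-T 0 , inj₁ (m+n∸m≡n c 0)
    -- a higher one: the path enters T at column a' high enough
    critical (suc q) q≤r p = p , new-cell-not-in-T (suc q) , inj₂ (empty-below ,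
        a' , b' , s<a' , rank⇒path a' b' 1≤a' b'≡ , cell-in-T b' b'≡ , cells-before-not-in-T ,
        subst (_≤ suc b') (sym (m+n∸m≡n c (suc q))) (subst (suc q ≤_) b'≡ (at-least (suc q) p)))
      where
      bounds = Equivalence.from on-path⇔ (suc q , q≤r , p)
      open FirstColumnInT (proj₁ bounds) (proj₂ bounds)
      empty-below : 0 < (c + suc q) ∸ height Tw s
      empty-below = subst (0 <_) (sym (m+n∸m≡n c (suc q))) (s≤s z≤n)
      b' = pred (rank a' (suc k))
      b'≡ : rank a' (suc k) ≡ suc b'
      b'≡ = sym (suc-pred (rank a' (suc k)) {{>-nonZero (≤-trans (s≤s z≤n) (at-least (suc q) p))}})

lemma5p5 : (w : List ℕ) → Reduced w → (k i j : ℕ) → 1 ≤ k → 1 ≤ i → i < j →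
    inv (λ x → evalWord w (transp i j x)) (suc (maxL w) ⊔ j) ≡ suc (inv (evalWord w) (suc (maxL w) ⊔ j)) →
    (w' : List ℕ) → Reduced w' → (∀ x → evalWord w' x ≡ evalWord w (transp i j x)) →
    (s r : ℕ) → 1 ≤ s → index (towerOf w) s ≡ i →
    height (towerOf w') s ≡ height (towerOf w) s + suc r →
    (((i ≤ k × k < j) ⇔ (∃[ q ] (q ≤ r × InPath (towerOf w) k s (height (towerOf w) s + q))))
    × (∀ q → q ≤ r → InPath (towerOf w) k s (height (towerOf w) s + q) →
    Critical (towerOf w) k s (height (towerOf w) s + q)))
lemma5p5 w red k i j 1≤k 1≤i i<j longer w' red' ω'≡ s r 1≤s index≡i grown =
  on-path⇔ k 1≤k , critical k 1≤k
  where open Cover w red i j 1≤i i<j longer w' red' ω'≡ s r 1≤s index≡i grown
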